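{- Let $q$ be a prime power and $n\ge 1$. If two $n\times n$ Dickson matrices over $\mathbb{F}_{q^n}$ have equal corresponding principal minors, then they have the same rank.
   Context: A Dickson matrix is an $n\times n$ matrix $A$ with rows and columns indexed by $\mathbb{Z}_n$ such that $A[i|j]=a_{j-i}^{q^i}$ for some $a_0,\dots,a_{n-1}\in\mathbb{F}_{q^n}$. Corresponding principal minors: $\det A[\alpha|\alpha]=\det B[\alpha|\alpha]$ for all $\alpha\subseteq\mathbb{Z}_n$, where $A[\alpha|\beta]$ is the submatrix with rows in $\alpha$ and columns in $\beta$. -}

module Defs where

open import Level using (Level; _⊔_)
open import Data.Nat as ℕ using (ℕ; zero; suc; NonZero; _≤_)
open import Data.Nat.DivMod using (_%_; m%n<n)
open import Data.Nat.Primality using (Prime)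
open import Data.Fin as Fin using (Fin; toℕ; fromℕ<; punchIn)
open import Data.Fin.Subset using (Subset)
open import Data.Fin.Subset.Properties using (_∈?_)
open import Data.List as List using (List; length; lookup; filter; allFin; foldr)
open import Data.List.Relation.Unary.Any using (Any)
open import Data.List.Relation.Unary.AllPairs using (AllPairs)
open import Data.Product using (Σ; ∃; ∃-syntax; _×_; _,_)
open import Relation.Nullary using (¬_)
open import Relation.Binary.PropositionalEquality using (_≡_)
open import Algebra.Bundles using (CommutativeRing)

IsPrimePower : ℕ → Set
IsPrimePower q = ∃[ p ] ∃[ k ] (Prime p × 1 ≤ k × q ≡ p ℕ.^ k)

_⊖_ : ∀ {n} .{{_ : NonZero n}} → Fin n → Fin n → Fin n
_⊖_ {n} j i = fromℕ< (m%n<n (toℕ j ℕ.+ (n ℕ.∸ toℕ i)) n)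

module Over {c ℓ : Level} (R : CommutativeRing c ℓ) where
  open CommutativeRing R

  pow : Carrier → ℕ → Carrier
  pow x zero    = 1#
  pow x (suc m) = x * pow x m

  record IsFiniteFieldOfOrder (m : ℕ) : Set (c ⊔ ℓ) where
    field
      nontrivial : ¬ (1# ≈ 0#)
      inverse    : ∀ x → ¬ (x ≈ 0#) → ∃[ y ] (x * y ≈ 1#)
      elements   : List Carrier
      complete   : ∀ x → Any (x ≈_) elements
      distinct   : AllPairs (λ a b → ¬ (a ≈ b)) elements
      card       : length elements ≡ m

  Matrix : ℕ → Set c
  Matrix n = Fin n → Fin n → Carrier

  signed : ℕ → Carrier → Carrier
  signed zero    x = x
  signed (suc k) x = - signed k x

  det : ∀ {k} → Matrix k → Carrier
  det {zero}  M = 1#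
  det {suc k} M = foldr _+_ 0# (List.map term (allFin (suc k)))
    where
      term : Fin (suc k) → Carrier
      term j = signed (toℕ j) (M Fin.zero j * det (λ r s → M (Fin.suc r) (punchIn j s)))

  IsDickson : (q n : ℕ) .{{_ : NonZero n}} → Matrix n → Set (c ⊔ ℓ)
  IsDickson q n A = Σ (Fin n → Carrier) λ a → (∀ i j → A i j ≈ pow (a (j ⊖ i)) (q ℕ.^ toℕ i))

  elems : ∀ {n} → Subset n → List (Fin n)
  elems {n} α = filter (_∈? α) (allFin n)

  principalMinor : ∀ {n} → Matrix n → Subset n → Carrier
  principalMinor A α = det (λ i j → A (lookup (elems α) i) (lookup (elems α) j))

  HasNonzeroMinor : ∀ {n} → Matrix n → ℕ → Set ℓ
  HasNonzeroMinor {n} A k =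
    Σ (Fin k → Fin n) λ rows → Σ (Fin k → Fin n) λ cols → ¬ (det {k} (λ i j → A (rows i) (cols j)) ≈ 0#)

  IsRank : ∀ {n} → Matrix n → ℕ → Set ℓ
  IsRank A r = HasNonzeroMinor A r × (∀ k → HasNonzeroMinor A k → k ≤ r)

{-# OPTIONS --safe #-}
module Submission where

-- Over F_(q^n) the Frobenius map σ x = x^q is a ring endomorphism with σ^n = id, so a Dickson
-- matrix satisfies σ (A[i|j]) = A[i+1|j+1], indices taken mod n.  Applying σ to a linear
-- relation among columns therefore shifts it one column to the right.  If A has rank r, its
-- first r+1 columns are dependent; at the last nonzero coefficient some column lies in the span
-- of its predecessors, and shifting propagates this to every later column, so all columns of A
-- lie in the span of the first r.  The same holds for rows (apply it to the transpose).  Hence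
-- the leading principal r×r minor is nonzero: a relation among its columns would extend to the
-- first r columns of A and drop the rank below r.  This principal minor is also a minor of B,
-- so rank B ≥ rank A, and equality follows by symmetry.

open import Defs
open import Level using (Level; _⊔_)
open import Data.Nat as ℕ using (ℕ; zero; suc; NonZero)
import Data.Nat.Properties as ℕP
open import Data.Fin as Fin using (Fin; zero; suc; toℕ; punchIn; punchOut)
import Data.Fin.Properties as FinP
open import Data.List as List using (List; foldr; allFin)
import Data.List.Properties as ListP
open import Data.Product using (Σ; ∃; ∃-syntax; _×_; _,_; proj₁; proj₂)
open import Data.Sum using (_⊎_; inj₁; inj₂)
open import Data.Empty using (⊥-elim)
open import Relation.Nullary using (¬_; Dec; yes; no)
open import Relation.Binary.Definitions using (tri<; tri≈; tri>)
open import Relation.Binary.PropositionalEquality as ≡ using (_≡_; _≢_)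
open import Function using (_∘_; id)
open import Algebra.Bundles using (CommutativeMonoid; CommutativeRing; NearSemiring)
open import Data.Nat.Primality using (Prime; euclidsLemma; prime⇒nonTrivial)
open import Algebra.Morphism.Structures using (module NearSemiringMorphisms)
open NearSemiringMorphisms using (IsNearSemiringHomomorphism)

module SparseSums {a ℓ} (M : CommutativeMonoid a ℓ) where
  open CommutativeMonoid M
  open import Algebra.Properties.CommutativeMonoid.Sum M using (sum)

  sum-ε : ∀ {n} (f : Fin n → Carrier) → (∀ i → f i ≈ ε) → sum f ≈ ε
  sum-ε {zero}  f e = refl
  sum-ε {suc n} f e = trans (∙-cong (e zero) (sum-ε (f ∘ suc) (e ∘ suc))) (identityˡ _)

  sum-single : ∀ {n} (f : Fin n → Carrier) a → (∀ t → t ≢ a → f t ≈ ε) → sum f ≈ f a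
  sum-single {suc n} f zero e = trans (∙-congˡ (sum-ε (f ∘ suc) (λ t → e (suc t) λ ()))) (identityʳ _)
  sum-single {suc n} f (suc a) e =
    trans (∙-cong (e zero λ ()) (sum-single (f ∘ suc) a (λ t t≢a → e (suc t) (t≢a ∘ FinP.suc-injective)))) (identityˡ _)

  sum-pair : ∀ {n} (f : Fin n → Carrier) a b → a ≢ b → (∀ t → t ≢ a → t ≢ b → f t ≈ ε) → sum f ≈ f a ∙ f b
  sum-pair {suc n} f zero zero a≢b e = ⊥-elim (a≢b ≡.refl)
  sum-pair {suc n} f zero (suc b) a≢b e =
    ∙-congˡ (sum-single (f ∘ suc) b (λ t t≢b → e (suc t) (λ ()) (t≢b ∘ FinP.suc-injective)))
  sum-pair {suc n} f (suc a) zero a≢b e =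
    trans (∙-congˡ (sum-single (f ∘ suc) a (λ t t≢a → e (suc t) (t≢a ∘ FinP.suc-injective) (λ ())))) (comm _ _)
  sum-pair {suc n} f (suc a) (suc b) a≢b e =
    trans (∙-cong (e zero (λ ()) (λ ())) (sum-pair (f ∘ suc) a b (a≢b ∘ ≡.cong suc)
           (λ t t≢a t≢b → e (suc t) (t≢a ∘ FinP.suc-injective) (t≢b ∘ FinP.suc-injective)))) (identityˡ _)

module Determinant {c ℓ} (R : CommutativeRing c ℓ) where
  open CommutativeRing R hiding (zero)
  open Over R public using (Matrix; det; signed)
  open import Algebra.Properties.Ring ring using (-‿distribˡ-*; -‿distribʳ-*; -0#≈0#; -‿involutive; -‿+-comm; +-inverseʳ-unique)
  open import Algebra.Properties.CommutativeMonoid.Sum +-commutativeMonoid public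
    using (sum; sum-cong-≋; sum-remove; ∑-distrib-+; ∑-comm)
  open import Algebra.Properties.Semiring.Sum semiring public using (*-distribˡ-sum; *-distribʳ-sum)
  open SparseSums +-commutativeMonoid public renaming (sum-ε to sum-0#)
  open import Algebra.Properties.CommutativeSemigroup *-commutativeSemigroup using (x∙yz≈y∙xz)
  open import Relation.Binary.Reasoning.Setoid setoid

  signed-cong : ∀ k {x y} → x ≈ y → signed k x ≈ signed k y
  signed-cong zero    e = e
  signed-cong (suc k) e = -‿cong (signed-cong k e)

  signed-+ : ∀ k x y → signed k (x + y) ≈ signed k x + signed k y
  signed-+ zero    x y = refl
  signed-+ (suc k) x y = trans (-‿cong (signed-+ k x y)) (sym (-‿+-comm _ _))

  signed-0# : ∀ k → signed k 0# ≈ 0#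
  signed-0# zero    = refl
  signed-0# (suc k) = trans (-‿cong (signed-0# k)) -0#≈0#

  signed-*ˡ : ∀ k x y → signed k (x * y) ≈ x * signed k y
  signed-*ˡ zero    x y = refl
  signed-*ˡ (suc k) x y = trans (-‿cong (signed-*ˡ k x y)) (-‿distribʳ-* x _)

  minor : ∀ {k} → Matrix (suc k) → Fin (suc k) → Matrix k
  minor M j r s = M (suc r) (punchIn j s)

  expansionTerm : ∀ {k} → Matrix (suc k) → Fin (suc k) → Carrier
  expansionTerm M j = signed (toℕ j) (M zero j * det (minor M j))

  det-expansion : ∀ {k} (M : Matrix (suc k)) → det M ≡ sum (expansionTerm M)
  det-expansion M = ≡.trans (≡.cong (foldr _+_ 0#) (ListP.map-tabulate id (expansionTerm M))) (foldr-tabulate (expansionTerm M))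
    where
    foldr-tabulate : ∀ {n} (h : Fin n → Carrier) → foldr _+_ 0# (List.tabulate h) ≡ sum h
    foldr-tabulate {zero}  h = ≡.refl
    foldr-tabulate {suc n} h = ≡.cong (h zero +_) (foldr-tabulate (h ∘ suc))

  det-cong : ∀ {k} {M N : Matrix k} → (∀ i j → M i j ≈ N i j) → det M ≈ det N
  det-cong {zero}  e = refl
  det-cong {suc k} {M} {N} e = begin
    det M                    ≡⟨ det-expansion M ⟩
    sum (expansionTerm M)    ≈⟨ sum-cong-≋ {x = expansionTerm M} (λ j → signed-cong (toℕ j)
                                  (*-cong (e zero j) (det-cong (λ r s → e (suc r) (punchIn j s))))) ⟩
    sum (expansionTerm N)    ≡⟨ det-expansion N ⟨
    det N                    ∎

  SameOutside : ∀ {m k} (M N : Fin m → Fin k → Carrier) → Fin k → Set ℓ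
  SameOutside M N c = ∀ i j → j ≢ c → M i j ≈ N i j

  SameOutside₂ : ∀ {m k} (M N : Fin m → Fin k → Carrier) → Fin k → Fin k → Set ℓ
  SameOutside₂ M N a b = ∀ i j → j ≢ a → j ≢ b → M i j ≈ N i j

  private
    punchIn≡⇒≡punchOut : ∀ {k} {t c : Fin (suc k)} (t≢c : t ≢ c) s → punchIn t s ≡ c → s ≡ punchOut t≢c
    punchIn≡⇒≡punchOut {t = t} t≢c s e = ≡.trans (≡.sym (FinP.punchOut-punchIn t)) (FinP.punchOut-cong t e)

    minor-sameOutside : ∀ {k} {M N : Matrix (suc k)} {c t} → SameOutside M N c → (t≢c : t ≢ c) →
                        SameOutside (minor M t) (minor N t) (punchOut t≢c)
    minor-sameOutside same t≢c r s s≢c = same (suc r) _ (λ e → s≢c (punchIn≡⇒≡punchOut t≢c s e))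

    minor-punchOut : ∀ {k} (M : Matrix (suc k)) {c t} (t≢c : t ≢ c) r → minor M t r (punchOut t≢c) ≡ M (suc r) c
    minor-punchOut M t≢c r = ≡.cong (M (suc r)) (FinP.punchIn-punchOut t≢c)

    minor-same : ∀ {k} {M N : Matrix (suc k)} {c} → SameOutside M N c → ∀ r s → minor M c r s ≈ minor N c r s
    minor-same {c = c} same r s = same (suc r) (punchIn c s) (FinP.punchInᵢ≢i c s)

  det-+-column : ∀ {k} (M N P : Matrix k) c → SameOutside M N c → SameOutside M P c →
                 (∀ i → M i c ≈ N i c + P i c) → det M ≈ det N + det P
  det-+-column {zero}  M N P () sameN sameP e
  det-+-column {suc k} M N P c sameN sameP e = begin
    det M                                              ≡⟨ det-expansion M ⟩
    sum (expansionTerm M)                              ≈⟨ sum-cong-≋ {x = expansionTerm M} termwise ⟩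
    sum (λ t → expansionTerm N t + expansionTerm P t)  ≈⟨ ∑-distrib-+ (expansionTerm N) (expansionTerm P) ⟩
    sum (expansionTerm N) + sum (expansionTerm P)      ≡⟨ ≡.cong₂ _+_ (det-expansion N) (det-expansion P) ⟨
    det N + det P                                      ∎
    where
    termwise : ∀ t → expansionTerm M t ≈ expansionTerm N t + expansionTerm P t
    termwise t with t FinP.≟ c
    ... | yes ≡.refl = trans (signed-cong (toℕ t) (begin
            M zero t * det (minor M t)                               ≈⟨ *-congʳ (e zero) ⟩
            (N zero t + P zero t) * det (minor M t)                  ≈⟨ distribʳ _ _ _ ⟩
            N zero t * det (minor M t) + P zero t * det (minor M t)  ≈⟨ +-cong (*-congˡ (det-cong (minor-same sameN)))
                                                                              (*-congˡ (det-cong (minor-same sameP))) ⟩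
            N zero t * det (minor N t) + P zero t * det (minor P t)  ∎)) (signed-+ (toℕ t) _ _)
    ... | no t≢c = trans (signed-cong (toℕ t) (begin
            M zero t * det (minor M t)                               ≈⟨ *-congˡ minors ⟩
            M zero t * (det (minor N t) + det (minor P t))           ≈⟨ distribˡ _ _ _ ⟩
            M zero t * det (minor N t) + M zero t * det (minor P t)  ≈⟨ +-cong (*-congʳ (sameN zero t t≢c))
                                                                              (*-congʳ (sameP zero t t≢c)) ⟩
            N zero t * det (minor N t) + P zero t * det (minor P t)  ∎)) (signed-+ (toℕ t) _ _)
      where
      minors : det (minor M t) ≈ det (minor N t) + det (minor P t)
      minors = det-+-column (minor M t) (minor N t) (minor P t) (punchOut t≢c)
                 (minor-sameOutside sameN t≢c) (minor-sameOutside sameP t≢c)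
                 (λ r → trans (reflexive (minor-punchOut M t≢c r)) (trans (e (suc r))
                   (+-cong (reflexive (≡.sym (minor-punchOut N t≢c r))) (reflexive (≡.sym (minor-punchOut P t≢c r))))))

  det-*-column : ∀ {k} (M N : Matrix k) c a → SameOutside M N c → (∀ i → M i c ≈ a * N i c) → det M ≈ a * det N
  det-*-column {zero}  M N () a same e
  det-*-column {suc k} M N c a same e = begin
    det M                            ≡⟨ det-expansion M ⟩
    sum (expansionTerm M)            ≈⟨ sum-cong-≋ {x = expansionTerm M} termwise ⟩
    sum (λ t → a * expansionTerm N t) ≈⟨ *-distribˡ-sum a (expansionTerm N) ⟨
    a * sum (expansionTerm N)        ≡⟨ ≡.cong (a *_) (det-expansion N) ⟨
    a * det N                        ∎
    where
    termwise : ∀ t → expansionTerm M t ≈ a * expansionTerm N t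
    termwise t with t FinP.≟ c
    ... | yes ≡.refl = trans (signed-cong (toℕ t) (begin
            M zero t * det (minor M t)        ≈⟨ *-cong (e zero) (det-cong (minor-same same)) ⟩
            (a * N zero t) * det (minor N t)  ≈⟨ *-assoc _ _ _ ⟩
            a * (N zero t * det (minor N t))  ∎)) (signed-*ˡ (toℕ t) _ _)
    ... | no t≢c = trans (signed-cong (toℕ t) (begin
            M zero t * det (minor M t)        ≈⟨ *-cong (same zero t t≢c) minors ⟩
            N zero t * (a * det (minor N t))  ≈⟨ x∙yz≈y∙xz _ _ _ ⟩
            a * (N zero t * det (minor N t))  ∎)) (signed-*ˡ (toℕ t) _ _)
      where
      minors : det (minor M t) ≈ a * det (minor N t)
      minors = det-*-column (minor M t) (minor N t) (punchOut t≢c) a (minor-sameOutside same t≢c)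
                 (λ r → trans (reflexive (minor-punchOut M t≢c r))
                          (trans (e (suc r)) (*-congˡ (reflexive (≡.sym (minor-punchOut N t≢c r))))))

  det-zero-column : ∀ {k} (M : Matrix k) c → (∀ i → M i c ≈ 0#) → det M ≈ 0#
  det-zero-column M c e = trans (det-*-column M M c 0# (λ i j _ → refl) (λ i → trans (e i) (sym (zeroˡ _)))) (zeroˡ _)

  setColumn : ∀ {m k} → (Fin m → Fin k → Carrier) → Fin k → (Fin m → Carrier) → Fin m → Fin k → Carrier
  setColumn M a v i j with j FinP.≟ a
  ... | yes _ = v i
  ... | no _  = M i j

  setColumn-at : ∀ {m k} (M : Fin m → Fin k → Carrier) a v i → setColumn M a v i a ≈ v i
  setColumn-at M a v i with a FinP.≟ a
  ... | yes _   = refl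
  ... | no a≢a = ⊥-elim (a≢a ≡.refl)

  setColumn-off : ∀ {m k} (M : Fin m → Fin k → Carrier) a v i j → j ≢ a → setColumn M a v i j ≈ M i j
  setColumn-off M a v i j j≢a with j FinP.≟ a
  ... | yes j≡a = ⊥-elim (j≢a j≡a)
  ... | no _    = refl

  setColumn-sameOutside : ∀ {m k} (M N : Fin m → Fin k → Carrier) a v w → SameOutside M N a →
                          SameOutside (setColumn M a v) (setColumn N a w) a
  setColumn-sameOutside M N a v w same i j j≢a =
    trans (setColumn-off M a v i j j≢a) (trans (same i j j≢a) (sym (setColumn-off N a w i j j≢a)))

  private
    punchIn-adjacent : ∀ {k} (a b : Fin (suc k)) → toℕ b ≡ suc (toℕ a) → ∀ s →
                       (punchIn a s ≡ punchIn b s) ⊎ (punchIn a s ≡ b × punchIn b s ≡ a)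
    punchIn-adjacent zero    (suc zero)     _ zero    = inj₂ (≡.refl , ≡.refl)
    punchIn-adjacent zero    (suc zero)     _ (suc s) = inj₁ ≡.refl
    punchIn-adjacent zero    (suc (suc b))  () s
    punchIn-adjacent (suc a) (suc b)        _ zero    = inj₁ ≡.refl
    punchIn-adjacent (suc a) (suc b)        e (suc s) with punchIn-adjacent a b (ℕP.suc-injective e) s
    ... | inj₁ same        = inj₁ (≡.cong suc same)
    ... | inj₂ (ab , ba)   = inj₂ (≡.cong suc ab , ≡.cong suc ba)

    adjacent⇒≢ : ∀ {k} {a b : Fin k} → toℕ b ≡ suc (toℕ a) → a ≢ b
    adjacent⇒≢ e a≡b = ℕP.1+n≢n (≡.sym (≡.trans (≡.cong toℕ a≡b) e))

  EqualColumnsVanish : ℕ → Set (c ⊔ ℓ)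
  EqualColumnsVanish k = ∀ (M : Matrix k) a b → a ≢ b → (∀ i → M i a ≈ M i b) → det M ≈ 0#

  module Alternation (k : ℕ) (vanish : EqualColumnsVanish k) where

    -- Equal adjacent columns a, a + 1 have equal minors along row zero, so their two expansion
    -- terms cancel; every other term has a minor with two equal columns.
    det-adjacent-equal : ∀ (M : Matrix (suc k)) a b → toℕ b ≡ suc (toℕ a) → (∀ i → M i a ≈ M i b) → det M ≈ 0#
    det-adjacent-equal M a b adj e = begin
      det M                                                           ≡⟨ det-expansion M ⟩
      sum (expansionTerm M)                                           ≈⟨ sum-pair (expansionTerm M) a b (adjacent⇒≢ adj) others ⟩
      expansionTerm M a + expansionTerm M b                           ≈⟨ +-congˡ termb ⟩
      expansionTerm M a + - signed (toℕ a) (M zero a * det (minor M a)) ≈⟨ -‿inverseʳ _ ⟩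
      0#                                                              ∎
      where
      others : ∀ t → t ≢ a → t ≢ b → expansionTerm M t ≈ 0#
      others t t≢a t≢b = trans (signed-cong (toℕ t) (trans (*-congˡ minor≈0) (zeroʳ _))) (signed-0# (toℕ t))
        where
        minor≈0 : det (minor M t) ≈ 0#
        minor≈0 = vanish (minor M t) (punchOut t≢a) (punchOut t≢b)
                    (λ e → adjacent⇒≢ adj (FinP.punchOut-injective t≢a t≢b e))
                    (λ r → trans (reflexive (minor-punchOut M t≢a r)) (trans (e (suc r)) (reflexive (≡.sym (minor-punchOut M t≢b r)))))
      minors : ∀ r s → minor M b r s ≈ minor M a r s
      minors r s with punchIn-adjacent a b adj s
      ... | inj₁ same     = reflexive (≡.cong (M (suc r)) (≡.sym same))
      ... | inj₂ (ab , ba) = trans (reflexive (≡.cong (M (suc r)) ba)) (trans (e (suc r)) (reflexive (≡.cong (M (suc r)) (≡.sym ab))))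
      termb : expansionTerm M b ≈ - signed (toℕ a) (M zero a * det (minor M a))
      termb = trans (reflexive (≡.cong (λ n → signed n (M zero b * det (minor M b))) adj))
                    (signed-cong (suc (toℕ a)) (*-cong (sym (e zero)) (det-cong minors)))

    -- Put colA + colB into both columns a and b: bilinearity and the adjacent case leave only
    -- the two mixed terms, which are det M and det M′.
    det-swap-adjacent : ∀ (M M′ : Matrix (suc k)) a b → toℕ b ≡ suc (toℕ a) →
                        (∀ i → M′ i a ≈ M i b) → (∀ i → M′ i b ≈ M i a) → SameOutside₂ M′ M a b →
                        det M′ ≈ - det M
    det-swap-adjacent M M′ a b adj ea eb eo = +-inverseʳ-unique _ _ (begin
        det M + det M′                                   ≈⟨ +-cong (sym (trans (+-congʳ (zeroWith colA)) (trans (+-identityˡ _) withAB)))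
                                                                   (sym (trans (+-congˡ (zeroWith colB)) (trans (+-identityʳ _) withBA))) ⟩
        (det (with₂ colA colA) + det (with₂ colA colB)) + (det (with₂ colB colA) + det (with₂ colB colB))
                                                         ≈⟨ +-cong (splitSecond colA) (splitSecond colB) ⟨
        det (with₂ colA both) + det (with₂ colB both)    ≈⟨ splitFirst both ⟨
        det (with₂ both both)                            ≈⟨ zeroWith both ⟩
        0#                                               ∎)
      where
      a≢b = adjacent⇒≢ adj
      colA colB both : Fin (suc k) → Carrier
      colA i = M i a
      colB i = M i b
      both i = M i a + M i b
      with₂ : (Fin (suc k) → Carrier) → (Fin (suc k) → Carrier) → Matrix (suc k)
      with₂ v w = setColumn (setColumn M a v) b w
      with₂-a : ∀ v w i → with₂ v w i a ≈ v i
      with₂-a v w i = trans (setColumn-off _ b w i a a≢b) (setColumn-at M a v i)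
      with₂-b : ∀ v w i → with₂ v w i b ≈ w i
      with₂-b v w i = setColumn-at _ b w i
      zeroWith : ∀ v → det (with₂ v v) ≈ 0#
      zeroWith v = det-adjacent-equal (with₂ v v) a b adj (λ i → trans (with₂-a v v i) (sym (with₂-b v v i)))
      splitFirst : ∀ w → det (with₂ both w) ≈ det (with₂ colA w) + det (with₂ colB w)
      splitFirst w = det-+-column _ _ _ a (sameA colA) (sameA colB)
                       (λ i → trans (with₂-a both w i) (sym (+-cong (with₂-a colA w i) (with₂-a colB w i))))
        where
        sameA : ∀ v → SameOutside (with₂ both w) (with₂ v w) a
        sameA v i j j≢a = byCase (j FinP.≟ b)
          where
          byCase : Dec (j ≡ b) → with₂ both w i j ≈ with₂ v w i j
          byCase (yes j≡b) = ≡.subst (λ j → with₂ both w i j ≈ with₂ v w i j) (≡.sym j≡b)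
                               (trans (with₂-b both w i) (sym (with₂-b v w i)))
          byCase (no j≢b)  = trans (setColumn-off _ b w i j j≢b) (trans (setColumn-off M a both i j j≢a)
                               (sym (trans (setColumn-off _ b w i j j≢b) (setColumn-off M a v i j j≢a))))
      splitSecond : ∀ v → det (with₂ v both) ≈ det (with₂ v colA) + det (with₂ v colB)
      splitSecond v = det-+-column _ _ _ b (sameB colA) (sameB colB)
                        (λ i → trans (with₂-b v both i) (sym (+-cong (with₂-b v colA i) (with₂-b v colB i))))
        where
        sameB : ∀ w → SameOutside (with₂ v both) (with₂ v w) b
        sameB w i j j≢b = trans (setColumn-off _ b both i j j≢b) (sym (setColumn-off _ b w i j j≢b))
      matches : ∀ (N : Matrix (suc k)) v w → (∀ i → N i a ≈ v i) → (∀ i → N i b ≈ w i) → SameOutside₂ N M a b →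
                det (with₂ v w) ≈ det N
      matches N v w na nb nrest = det-cong entry
        where
        entry : ∀ i j → with₂ v w i j ≈ N i j
        entry i j = byCase (j FinP.≟ a) (j FinP.≟ b)
          where
          byCase : Dec (j ≡ a) → Dec (j ≡ b) → with₂ v w i j ≈ N i j
          byCase (yes j≡a) _        = ≡.subst (λ j → with₂ v w i j ≈ N i j) (≡.sym j≡a) (trans (with₂-a v w i) (sym (na i)))
          byCase (no _) (yes j≡b)   = ≡.subst (λ j → with₂ v w i j ≈ N i j) (≡.sym j≡b) (trans (with₂-b v w i) (sym (nb i)))
          byCase (no j≢a) (no j≢b)  = trans (setColumn-off _ b w i j j≢b) (trans (setColumn-off M a v i j j≢a) (sym (nrest i j j≢a j≢b)))
      withAB : det (with₂ colA colB) ≈ det M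
      withAB = matches M colA colB (λ _ → refl) (λ _ → refl) (λ _ _ _ _ → refl)
      withBA : det (with₂ colB colA) ≈ det M′
      withBA = matches M′ colB colA ea eb eo

    -- Swapping column b with its left neighbour b′ negates det and moves the equal columns closer.
    det-equal-columns-apart : ∀ d (M : Matrix (suc k)) a b → toℕ b ≡ suc (d ℕ.+ toℕ a) → (∀ i → M i a ≈ M i b) → det M ≈ 0#
    det-equal-columns-apart zero    M a b e equal = det-adjacent-equal M a b e equal
    det-equal-columns-apart (suc d) M a b e equal = begin
      det M       ≈⟨ -‿involutive _ ⟨
      - (- det M) ≈⟨ -‿cong swapped ⟨
      - det M′    ≈⟨ -‿cong (det-equal-columns-apart d M′ a b′ (FinP.toℕ-fromℕ< b′<) equal′) ⟩
      - 0#        ≈⟨ -0#≈0# ⟩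
      0#          ∎
      where
      b′< : suc (d ℕ.+ toℕ a) ℕ.< suc k
      b′< = ℕP.<-trans (ℕP.n<1+n _) (≡.subst (ℕ._< suc k) e (FinP.toℕ<n b))
      b′ : Fin (suc k)
      b′ = Fin.fromℕ< b′<
      adj : toℕ b ≡ suc (toℕ b′)
      adj = ≡.trans e (≡.cong suc (≡.sym (FinP.toℕ-fromℕ< b′<)))
      b′≢b = adjacent⇒≢ adj
      M′ = setColumn (setColumn M b′ (λ i → M i b)) b (λ i → M i b′)
      M′-b′ : ∀ i → M′ i b′ ≈ M i b
      M′-b′ i = trans (setColumn-off _ b _ i b′ b′≢b) (setColumn-at M b′ _ i)
      M′-off : SameOutside₂ M′ M b′ b
      M′-off i j j≢b′ j≢b = trans (setColumn-off _ b _ i j j≢b) (setColumn-off M b′ _ i j j≢b′)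
      swapped : det M′ ≈ - det M
      swapped = det-swap-adjacent M M′ b′ b adj M′-b′ (setColumn-at _ b _) M′-off
      equal′ : ∀ i → M′ i a ≈ M′ i b′
      equal′ i = trans (M′-off i a a≢b′ a≢b) (trans (equal i) (sym (M′-b′ i)))
        where
        a≢b′ : a ≢ b′
        a≢b′ eq = ℕP.m≢1+n+m (toℕ a) (≡.trans (≡.cong toℕ eq) (FinP.toℕ-fromℕ< b′<))
        a≢b : a ≢ b
        a≢b eq = ℕP.m≢1+n+m (toℕ a) (≡.trans (≡.cong toℕ eq) e)

    equalColumnsVanish : EqualColumnsVanish (suc k)
    equalColumnsVanish M a b a≢b equal with ℕP.<-cmp (toℕ a) (toℕ b)
    ... | tri< a<b _ _ = det-equal-columns-apart d M a b (≡.sym (≡.trans (≡.cong suc (ℕP.+-comm d (toℕ a))) a+d≡b)) equal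
      where open Σ (ℕP.m≤n⇒∃[o]m+o≡n a<b) renaming (proj₁ to d; proj₂ to a+d≡b)
    ... | tri≈ _ a≡b _ = ⊥-elim (a≢b (FinP.toℕ-injective a≡b))
    ... | tri> _ _ b<a = det-equal-columns-apart d M b a (≡.sym (≡.trans (≡.cong suc (ℕP.+-comm d (toℕ b))) b+d≡a)) (λ i → sym (equal i))
      where open Σ (ℕP.m≤n⇒∃[o]m+o≡n b<a) renaming (proj₁ to d; proj₂ to b+d≡a)

  det-equal-columns : ∀ {k} → EqualColumnsVanish k
  det-equal-columns {zero}  M ()
  det-equal-columns {suc k} = Alternation.equalColumnsVanish k det-equal-columns

  nonzeroMinor⇒≤ : ∀ {n m} (A : Matrix n) → Over.HasNonzeroMinor R A m → m ℕ.≤ n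
  nonzeroMinor⇒≤ {n} {m} A (rows , cols , minor≉0) with m ℕ.≤? n
  ... | yes m≤n = m≤n
  ... | no m≰n with FinP.pigeonhole (ℕP.≰⇒> m≰n) cols
  ...   | i , j , i<j , same = ⊥-elim (minor≉0 (det-equal-columns _ i j (λ i≡j → ℕP.<-irrefl (≡.cong toℕ i≡j) i<j)
                                   (λ r → reflexive (≡.cong (A (rows r)) same))))

  private
    setColumn-twice : ∀ {m k} (M : Fin m → Fin k → Carrier) a v w i j → setColumn (setColumn M a v) a w i j ≈ setColumn M a w i j
    setColumn-twice M a v w i j with j FinP.≟ a
    ... | yes _   = refl
    ... | no j≢a = setColumn-off M a v i j j≢a

    setColumn-self : ∀ {m k} (M : Fin m → Fin k → Carrier) a i j → setColumn M a (λ i → M i a) i j ≈ M i j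
    setColumn-self M a i j with j FinP.≟ a
    ... | yes j≡a = reflexive (≡.cong (M i) (≡.sym j≡a))
    ... | no _    = refl

  det-sum-column : ∀ {k} n (M : Matrix k) a (F : Fin n → Fin k → Carrier) →
                   (∀ i → M i a ≈ sum (λ t → F t i)) → det M ≈ sum (λ t → det (setColumn M a (F t)))
  det-sum-column zero    M a F e = det-zero-column M a e
  det-sum-column (suc n) M a F e = begin
    det M                                                       ≈⟨ det-+-column M (setColumn M a (F zero)) M′ a
                                                                     (λ i j j≢a → sym (setColumn-off M a _ i j j≢a))
                                                                     (λ i j j≢a → sym (setColumn-off M a _ i j j≢a))
                                                                     (λ i → trans (e i) (sym (+-cong (setColumn-at M a _ i) (setColumn-at M a _ i)))) ⟩
    det (setColumn M a (F zero)) + det M′                       ≈⟨ +-congˡ (det-sum-column n M′ a (F ∘ suc) (setColumn-at M a rest)) ⟩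
    det (setColumn M a (F zero)) + sum (λ t → det (setColumn M′ a (F (suc t))))
                                                                ≈⟨ +-congˡ (sum-cong-≋ {x = λ t → det (setColumn M′ a (F (suc t)))}
                                                                     (λ t → det-cong (setColumn-twice M a rest (F (suc t))))) ⟩
    det (setColumn M a (F zero)) + sum (λ t → det (setColumn M a (F (suc t)))) ∎
    where
    rest : _ → Carrier
    rest i = sum (λ t → F (suc t) i)
    M′ = setColumn M a rest

  IsColumnRelation : ∀ {m k} → (Fin m → Fin k → Carrier) → (Fin k → Carrier) → Set ℓ
  IsColumnRelation M μ = ∀ i → sum (λ t → μ t * M i t) ≈ 0#

  -- Putting Σ μ t (column t) into column a gives a zero column; expanding it by linearity leaves
  -- μ a * det M, since every other term has a repeated column.
  columnRelation⇒coefficient*det≈0 : ∀ {k} (M : Matrix k) (μ : Fin k → Carrier) a →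
                                     IsColumnRelation M μ → μ a * det M ≈ 0#
  columnRelation⇒coefficient*det≈0 {k} M μ a rel = begin
    μ a * det M                                           ≈⟨ *-congˡ (det-cong (λ i j → sym (setColumn-self M a i j))) ⟩
    μ a * det (withColumn a)                              ≈⟨ sum-single (λ t → μ t * det (withColumn t)) a vanish ⟨
    sum (λ t → μ t * det (withColumn t))                  ≈⟨ sum-cong-≋ {x = λ t → det (setColumn M′ a (λ i → μ t * M i t))} scale ⟨
    sum (λ t → det (setColumn M′ a (λ i → μ t * M i t)))  ≈⟨ det-sum-column k M′ a (λ t i → μ t * M i t) (setColumn-at M a combo) ⟨
    det M′                                                ≈⟨ det-zero-column M′ a (λ i → trans (setColumn-at M a combo i) (rel i)) ⟩
    0#                                                    ∎
    where
    combo : _ → Carrier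
    combo i = sum (λ t → μ t * M i t)
    M′ = setColumn M a combo
    withColumn : Fin k → Matrix k
    withColumn t = setColumn M a (λ i → M i t)
    vanish : ∀ t → t ≢ a → μ t * det (withColumn t) ≈ 0#
    vanish t t≢a = trans (*-congˡ (det-equal-columns (withColumn t) a t (λ e → t≢a (≡.sym e))
                     (λ i → trans (setColumn-at M a _ i) (sym (setColumn-off M a _ i t t≢a))))) (zeroʳ _)
    scale : ∀ t → det (setColumn M′ a (λ i → μ t * M i t)) ≈ μ t * det (withColumn t)
    scale t = det-*-column _ _ a (μ t) (setColumn-sameOutside M′ M a _ _ (λ i j j≢a → setColumn-off M a combo i j j≢a))
                (λ i → trans (setColumn-at M′ a _ i) (*-congˡ (sym (setColumn-at M a _ i))))

  det-add-multiple-of-column : ∀ {k} (N N′ : Matrix k) a b x → b ≢ a → SameOutside N′ N b →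
                               (∀ i → N′ i b ≈ N i b + x * N i a) → det N′ ≈ det N
  det-add-multiple-of-column {k} N N′ a b x b≢a same e = begin
    det N′                                     ≈⟨ det-+-column N′ N P b same (λ i j j≢b → trans (same i j j≢b) (sym (setColumn-off N b _ i j j≢b)))
                                                    (λ i → trans (e i) (+-congˡ (sym (setColumn-at N b _ i)))) ⟩
    det N + det P                              ≈⟨ +-congˡ (det-*-column P (setColumn N b (λ i → N i a)) b x
                                                    (setColumn-sameOutside N N b _ _ (λ _ _ _ → refl))
                                                    (λ i → trans (setColumn-at N b _ i) (*-congˡ (sym (setColumn-at N b _ i))))) ⟩
    det N + x * det (setColumn N b (λ i → N i a)) ≈⟨ +-congˡ (*-congˡ (det-equal-columns _ b a b≢a
                                                    (λ i → trans (setColumn-at N b _ i) (sym (setColumn-off N b _ i a (λ a≡b → b≢a (≡.sym a≡b))))))) ⟩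
    det N + x * 0#                             ≈⟨ +-congˡ (zeroʳ x) ⟩
    det N + 0#                                 ≈⟨ +-identityʳ _ ⟩
    det N                                      ∎
    where
    P = setColumn N b (λ i → x * N i a)

  module _ {k} (L : Matrix k) (a : Fin k) (cf : Fin k → Carrier) (cf-a : cf a ≈ 0#) where
    private
      -- cf restricted to the columns j with toℕ j < s: the columns are cleared one at a time.
      below : ℕ → Fin k → Carrier
      below s j with toℕ j ℕ.<? s
      ... | yes _ = cf j
      ... | no _  = 0#

      below-a : ∀ s → below s a ≈ 0#
      below-a s with toℕ a ℕ.<? s
      ... | yes _ = cf-a
      ... | no _  = refl

      below-0 : ∀ j → below 0 j ≈ 0#
      below-0 j with toℕ j ℕ.<? 0
      ... | no _ = refl

      below-suc-≢ : ∀ s j → toℕ j ≢ s → below (suc s) j ≈ below s j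
      below-suc-≢ s j j≢s with toℕ j ℕ.<? suc s | toℕ j ℕ.<? s
      ... | yes _   | yes _   = refl
      ... | no _    | no _    = refl
      ... | yes j<1+s | no j≮s = ⊥-elim (j≮s (ℕP.≤∧≢⇒< (ℕP.≤-pred j<1+s) j≢s))
      ... | no j≮1+s | yes j<s = ⊥-elim (j≮1+s (ℕP.m<n⇒m<1+n j<s))

      below-suc-≡ : ∀ s j → toℕ j ≡ s → below (suc s) j ≈ cf j
      below-suc-≡ s j j≡s with toℕ j ℕ.<? suc s
      ... | yes _     = refl
      ... | no j≮1+s = ⊥-elim (j≮1+s (ℕP.≤-reflexive (≡.cong suc j≡s)))

      below-≡ : ∀ s j → toℕ j ≡ s → below s j ≈ 0#
      below-≡ s j j≡s with toℕ j ℕ.<? s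
      ... | yes j<s = ⊥-elim (ℕP.<-irrefl j≡s j<s)
      ... | no _    = refl

      below-k : ∀ j → below k j ≈ cf j
      below-k j with toℕ j ℕ.<? k
      ... | yes _   = refl
      ... | no j≮k = ⊥-elim (j≮k (FinP.toℕ<n j))

      subtracted : ℕ → Matrix k
      subtracted s i j = L i j - below s j * L i a

      subtracted-a : ∀ s i → subtracted s i a ≈ L i a
      subtracted-a s i = trans (+-congˡ (trans (-‿cong (trans (*-congʳ (below-a s)) (zeroˡ _))) -0#≈0#)) (+-identityʳ _)

      subtracted-step : ∀ s → det (subtracted (suc s)) ≈ det (subtracted s)
      subtracted-step s with s ℕ.<? k
      ... | no s≮k = det-cong (λ i j → +-congˡ (-‿cong (*-congʳ (below-suc-≢ s j (λ j≡s → s≮k (≡.subst (ℕ._< k) j≡s (FinP.toℕ<n j)))))))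
      ... | yes s<k with Fin.fromℕ< s<k FinP.≟ a
      ...   | yes s≡a = det-cong (λ i j → +-congˡ (-‿cong (*-congʳ (unchanged j))))
        where
        unchanged : ∀ j → below (suc s) j ≈ below s j
        unchanged j with toℕ j ℕ.≟ s
        ... | no j≢s  = below-suc-≢ s j j≢s
        ... | yes j≡s = trans (below-suc-≡ s j j≡s)
                          (trans (reflexive (≡.cong cf (≡.trans (FinP.toℕ-injective (≡.trans j≡s (≡.sym (FinP.toℕ-fromℕ< s<k)))) s≡a)))
                          (trans cf-a (sym (below-≡ s j j≡s))))
      ...   | no s≢a = det-add-multiple-of-column (subtracted s) (subtracted (suc s)) a j₀ (- cf j₀) s≢a same column
        where
        j₀ = Fin.fromℕ< s<k
        j₀≡s : toℕ j₀ ≡ s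
        j₀≡s = FinP.toℕ-fromℕ< s<k
        same : SameOutside (subtracted (suc s)) (subtracted s) j₀
        same i j j≢j₀ = +-congˡ (-‿cong (*-congʳ (below-suc-≢ s j (λ j≡s → j≢j₀ (FinP.toℕ-injective (≡.trans j≡s (≡.sym j₀≡s)))))))
        column : ∀ i → subtracted (suc s) i j₀ ≈ subtracted s i j₀ + (- cf j₀) * subtracted s i a
        column i = begin
          L i j₀ - below (suc s) j₀ * L i a  ≈⟨ +-congˡ (-‿cong (*-congʳ (below-suc-≡ s j₀ j₀≡s))) ⟩
          L i j₀ - cf j₀ * L i a             ≈⟨ +-cong (sym (trans (+-congˡ (trans (-‿cong (trans (*-congʳ (below-≡ s j₀ j₀≡s)) (zeroˡ _))) -0#≈0#))
                                                                  (+-identityʳ _)))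
                                                       (trans (-‿distribˡ-* _ _) (*-congˡ (sym (subtracted-a s i)))) ⟩
          subtracted s i j₀ + (- cf j₀) * subtracted s i a ∎

      det-subtracted : ∀ s → det (subtracted s) ≈ det L
      det-subtracted zero    = det-cong (λ i j → trans (+-congˡ (trans (-‿cong (trans (*-congʳ (below-0 j)) (zeroˡ _))) -0#≈0#)) (+-identityʳ _))
      det-subtracted (suc s) = trans (subtracted-step s) (det-subtracted s)

    det-subtract-multiples-of-column : det (λ i j → L i j - cf j * L i a) ≈ det L
    det-subtract-multiples-of-column = trans (det-cong (λ i j → +-congˡ (-‿cong (*-congʳ (sym (below-k j)))))) (det-subtracted k)

  eliminate : ∀ {k m} → (Fin (suc k) → Fin (suc m) → Carrier) → Fin (suc m) → Carrier → Fin k → Fin m → Carrier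
  eliminate M a w r s = M (suc r) (punchIn a s) - (M zero (punchIn a s) * w) * M (suc r) a

  -- Clear row zero outside the pivot (0, a) with column operations; the expansion along row zero
  -- then has the single term at a, whose minor is the eliminated matrix.
  det-eliminate : ∀ {k} (L : Matrix (suc k)) a w → L zero a * w ≈ 1# → det L ≈ signed (toℕ a) (L zero a * det (eliminate L a w))
  det-eliminate {k} L a w inverse = begin
    det L                                            ≈⟨ det-subtract-multiples-of-column L a cf cf-a ⟨
    det cleared                                      ≡⟨ det-expansion cleared ⟩
    sum (expansionTerm cleared)                      ≈⟨ sum-single (expansionTerm cleared) a others ⟩
    expansionTerm cleared a                          ≈⟨ signed-cong (toℕ a) (*-cong (cleared-pivot) (det-cong minors)) ⟩
    signed (toℕ a) (L zero a * det (eliminate L a w)) ∎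
    where
    cf : Fin (suc k) → Carrier
    cf j with j FinP.≟ a
    ... | yes _ = 0#
    ... | no _  = L zero j * w
    cf-a : cf a ≈ 0#
    cf-a with a FinP.≟ a
    ... | yes _   = refl
    ... | no a≢a = ⊥-elim (a≢a ≡.refl)
    cf-off : ∀ j → j ≢ a → cf j ≈ L zero j * w
    cf-off j j≢a with j FinP.≟ a
    ... | yes j≡a = ⊥-elim (j≢a j≡a)
    ... | no _    = refl
    cleared : Matrix (suc k)
    cleared i j = L i j - cf j * L i a
    cleared-pivot : cleared zero a ≈ L zero a
    cleared-pivot = trans (+-congˡ (trans (-‿cong (trans (*-congʳ cf-a) (zeroˡ _))) -0#≈0#)) (+-identityʳ _)
    others : ∀ t → t ≢ a → expansionTerm cleared t ≈ 0#
    others t t≢a = trans (signed-cong (toℕ t) (trans (*-congʳ entry≈0) (zeroˡ _))) (signed-0# (toℕ t))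
      where
      entry≈0 : cleared zero t ≈ 0#
      entry≈0 = begin
        L zero t - cf t * L zero a             ≈⟨ +-congˡ (-‿cong (*-congʳ (cf-off t t≢a))) ⟩
        L zero t - (L zero t * w) * L zero a   ≈⟨ +-congˡ (-‿cong (*-assoc _ _ _)) ⟩
        L zero t - L zero t * (w * L zero a)   ≈⟨ +-congˡ (-‿cong (*-congˡ (trans (*-comm _ _) inverse))) ⟩
        L zero t - L zero t * 1#               ≈⟨ +-congˡ (-‿cong (*-identityʳ _)) ⟩
        L zero t - L zero t                    ≈⟨ -‿inverseʳ _ ⟩
        0#                                     ∎
    minors : ∀ r s → minor cleared a r s ≈ eliminate L a w r s
    minors r s = +-congˡ (-‿cong (*-congʳ (cf-off (punchIn a s) (FinP.punchInᵢ≢i a s))))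

record IsDiscreteField {c ℓ} (R : CommutativeRing c ℓ) : Set (c ⊔ ℓ) where
  open CommutativeRing R
  infix 4 _≟_
  field
    _≟_     : ∀ x y → Dec (x ≈ y)
    1≉0     : ¬ 1# ≈ 0#
    inverse : ∀ x → ¬ x ≈ 0# → ∃[ y ] x * y ≈ 1#

module LinearAlgebra {c ℓ} (R : CommutativeRing c ℓ) (F : IsDiscreteField R) where
  open CommutativeRing R hiding (zero)
  open IsDiscreteField F
  open Determinant R
  open import Algebra.Properties.Ring ring using (-‿distribˡ-*; -0#≈0#; -‿involutive)
  open import Relation.Nullary.Decidable using (¬?; decidable-stable)
  open import Relation.Binary.Reasoning.Setoid setoid

  x*y≈0⇒y≈0 : ∀ {x y} → ¬ x ≈ 0# → x * y ≈ 0# → y ≈ 0#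
  x*y≈0⇒y≈0 {x} {y} x≉0 xy≈0 = begin
    y            ≈⟨ *-identityˡ y ⟨
    1# * y       ≈⟨ *-congʳ (trans (*-comm _ _) x⁻¹x) ⟨
    (x⁻¹ * x) * y ≈⟨ *-assoc _ _ _ ⟩
    x⁻¹ * (x * y) ≈⟨ *-congˡ xy≈0 ⟩
    x⁻¹ * 0#     ≈⟨ zeroʳ _ ⟩
    0#           ∎
    where open Σ (inverse x x≉0) renaming (proj₁ to x⁻¹; proj₂ to x⁻¹x)

  signed≈0⇒≈0 : ∀ k {x} → signed k x ≈ 0# → x ≈ 0#
  signed≈0⇒≈0 zero    e = e
  signed≈0⇒≈0 (suc k) e = signed≈0⇒≈0 k (trans (sym (-‿involutive _)) (trans (-‿cong e) -0#≈0#))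

  IsNonzero : ∀ {k} → (Fin k → Carrier) → Set ℓ
  IsNonzero μ = ∃[ t ] ¬ μ t ≈ 0#

  nonzero? : ∀ {k} (μ : Fin k → Carrier) → Dec (IsNonzero μ)
  nonzero? μ = FinP.any? (λ t → ¬? (μ t ≟ 0#))

  ¬nonzero⇒≈0 : ∀ {k} (μ : Fin k → Carrier) → ¬ IsNonzero μ → ∀ t → μ t ≈ 0#
  ¬nonzero⇒≈0 μ ¬nz t = decidable-stable (μ t ≟ 0#) (λ μt≉0 → ¬nz (t , μt≉0))

  ColumnsDependent : ∀ {m k} → (Fin m → Fin k → Carrier) → Set (c ⊔ ℓ)
  ColumnsDependent M = ∃[ μ ] (IsColumnRelation M μ × IsNonzero μ)

  dependent⇒det≈0 : ∀ {k} (M : Matrix k) → ColumnsDependent M → det M ≈ 0#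
  dependent⇒det≈0 M (μ , rel , a , μa≉0) = x*y≈0⇒y≈0 μa≉0 (columnRelation⇒coefficient*det≈0 M μ a rel)

  dependent-zeroRow : ∀ {m k} (M : Fin (suc m) → Fin k → Carrier) → (∀ t → M zero t ≈ 0#) →
                      ColumnsDependent (M ∘ suc) → ColumnsDependent M
  dependent-zeroRow M zeroRow (μ , rel , nz) = μ , rel′ , nz
    where
    rel′ : IsColumnRelation M μ
    rel′ zero    = sum-0# (λ t → μ t * M zero t) (λ t → trans (*-congˡ (zeroRow t)) (zeroʳ _))
    rel′ (suc r) = rel r

  -- The pivot column gets the coefficient −Σ ν s (M 0 s / M 0 a), which also makes row zero vanish.
  dependent-eliminate : ∀ {k m} (M : Fin (suc k) → Fin (suc m) → Carrier) a w → M zero a * w ≈ 1# →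
                        ColumnsDependent (eliminate M a w) → ColumnsDependent M
  dependent-eliminate M a w inverse (ν , rel , s₀ , νs₀≉0) = μ , rel′ , punchIn a s₀ , λ e → νs₀≉0 (trans (sym (μ-punchIn s₀)) e)
    where
    factor : Fin _ → Carrier
    factor s = M zero (punchIn a s) * w
    T : Carrier
    T = sum (λ s → ν s * factor s)
    μ : Fin _ → Carrier
    μ t with t FinP.≟ a
    ... | yes _   = - T
    ... | no t≢a = ν (punchOut (λ a≡t → t≢a (≡.sym a≡t)))
    μ-a : μ a ≈ - T
    μ-a with a FinP.≟ a
    ... | yes _   = refl
    ... | no a≢a = ⊥-elim (a≢a ≡.refl)
    μ-punchIn : ∀ s → μ (punchIn a s) ≈ ν s
    μ-punchIn s with punchIn a s FinP.≟ a
    ... | yes e = ⊥-elim (FinP.punchInᵢ≢i a s e)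
    ... | no _  = reflexive (≡.cong ν (≡.trans (FinP.punchOut-cong a ≡.refl) (FinP.punchOut-punchIn a)))
    split : ∀ i → sum (λ t → μ t * M i t) ≈ - T * M i a + sum (λ s → ν s * M i (punchIn a s))
    split i = trans (sum-remove {i = a} (λ t → μ t * M i t))
                (+-cong (*-congʳ μ-a) (sum-cong-≋ {x = λ s → μ (punchIn a s) * M i (punchIn a s)} (λ s → *-congʳ (μ-punchIn s))))
    T*column : ∀ i → T * M i a ≈ sum (λ s → ν s * (factor s * M i a))
    T*column i = trans (*-distribʳ-sum (M i a) (λ s → ν s * factor s)) (sum-cong-≋ {x = λ s → (ν s * factor s) * M i a} (λ s → *-assoc _ _ _))
    rel′ : IsColumnRelation M μ
    rel′ zero = begin
      sum (λ t → μ t * M zero t)                         ≈⟨ split zero ⟩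
      - T * M zero a + X                                 ≈⟨ +-congʳ (trans (sym (-‿distribˡ-* _ _)) (-‿cong T*pivot)) ⟩
      - X + X                                            ≈⟨ -‿inverseˡ X ⟩
      0#                                                 ∎
      where
      X = sum (λ s → ν s * M zero (punchIn a s))
      T*pivot : T * M zero a ≈ X
      T*pivot = trans (T*column zero) (sum-cong-≋ {x = λ s → ν s * (factor s * M zero a)} (λ s → *-congˡ (begin
        (M zero (punchIn a s) * w) * M zero a  ≈⟨ *-assoc _ _ _ ⟩
        M zero (punchIn a s) * (w * M zero a)  ≈⟨ *-congˡ (trans (*-comm _ _) inverse) ⟩
        M zero (punchIn a s) * 1#              ≈⟨ *-identityʳ _ ⟩
        M zero (punchIn a s)                   ∎)))
    rel′ (suc r) = begin
      sum (λ t → μ t * M (suc r) t)                                   ≈⟨ split (suc r) ⟩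
      - T * Y + sum (λ s → ν s * M (suc r) (punchIn a s))             ≈⟨ +-congˡ (sum-cong-≋ {x = λ s → ν s * M (suc r) (punchIn a s)} (λ s → *-congˡ (decompose s))) ⟩
      - T * Y + sum (λ s → ν s * (eliminate M a w r s + factor s * Y)) ≈⟨ +-congˡ (sum-cong-≋ {x = λ s → ν s * (eliminate M a w r s + factor s * Y)} (λ s → distribˡ _ _ _)) ⟩
      - T * Y + sum (λ s → ν s * eliminate M a w r s + ν s * (factor s * Y))
                                                                      ≈⟨ +-congˡ (∑-distrib-+ (λ s → ν s * eliminate M a w r s) (λ s → ν s * (factor s * Y))) ⟩
      - T * Y + (sum (λ s → ν s * eliminate M a w r s) + sum (λ s → ν s * (factor s * Y)))
                                                                      ≈⟨ +-congˡ (+-cong (rel r) (sym (T*column (suc r)))) ⟩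
      - T * Y + (0# + T * Y)                                          ≈⟨ +-congˡ (+-identityˡ _) ⟩
      - T * Y + T * Y                                                 ≈⟨ +-congʳ (sym (-‿distribˡ-* _ _)) ⟩
      - (T * Y) + T * Y                                               ≈⟨ -‿inverseˡ _ ⟩
      0#                                                              ∎
      where
      Y = M (suc r) a
      decompose : ∀ s → M (suc r) (punchIn a s) ≈ eliminate M a w r s + factor s * Y
      decompose s = sym (trans (+-assoc _ _ _) (trans (+-congˡ (-‿inverseˡ _)) (+-identityʳ _)))

  wide⇒dependent : ∀ {k m} → k ℕ.< m → (M : Fin k → Fin m → Carrier) → ColumnsDependent M
  wide⇒dependent {zero}  {suc m} _   M = (λ _ → 1#) , (λ ()) , zero , 1≉0
  wide⇒dependent {suc k} {suc m} k<m M with nonzero? (M zero)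
  ... | no ¬nz           = dependent-zeroRow M (¬nonzero⇒≈0 (M zero) ¬nz) (wide⇒dependent (ℕP.m<n⇒m<1+n (ℕP.≤-pred k<m)) (M ∘ suc))
  ... | yes (a , Ma≉0)   = dependent-eliminate M a (proj₁ (inverse _ Ma≉0)) (proj₂ (inverse _ Ma≉0)) (wide⇒dependent (ℕP.≤-pred k<m) _)

  det≈0⇒dependent : ∀ {k} (L : Matrix k) → det L ≈ 0# → ColumnsDependent L
  det≈0⇒dependent {zero}  L det≈0 = ⊥-elim (1≉0 det≈0)
  det≈0⇒dependent {suc k} L det≈0 with nonzero? (L zero)
  ... | no ¬nz         = dependent-zeroRow L (¬nonzero⇒≈0 (L zero) ¬nz) (wide⇒dependent (ℕP.n<1+n k) (L ∘ suc))
  ... | yes (a , La≉0) = dependent-eliminate L a w inv (det≈0⇒dependent _ eliminated≈0)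
    where
    open Σ (inverse _ La≉0) renaming (proj₁ to w; proj₂ to inv)
    eliminated≈0 : det (eliminate L a w) ≈ 0#
    eliminated≈0 = x*y≈0⇒y≈0 La≉0 (signed≈0⇒≈0 (toℕ a) (trans (sym (det-eliminate L a w inv)) det≈0))

  private
    _◂_ : ∀ {k m} → Fin m → (Fin k → Fin m) → Fin (suc k) → Fin m
    (x ◂ g) zero    = x
    (x ◂ g) (suc i) = g i

    any-function? : ∀ k m (P : (Fin k → Fin m) → Set ℓ) → (∀ f g → (∀ i → f i ≡ g i) → P f → P g) →
                    (∀ f → Dec (P f)) → Dec (∃ P)
    any-function? zero m P resp P? with P? (λ ())
    ... | yes p = yes (_ , p)
    ... | no ¬p = no (λ (f , p) → ¬p (resp f _ (λ ()) p))
    any-function? (suc k) m P resp P?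
      with FinP.any? (λ x → any-function? k m (λ g → P (x ◂ g)) (λ f g e → resp _ _ (λ { zero → ≡.refl ; (suc i) → e i })) (λ g → P? (x ◂ g)))
    ... | yes (x , g , p) = yes (x ◂ g , p)
    ... | no ¬p           = no (λ (f , p) → ¬p (f zero , f ∘ suc , resp f _ (λ { zero → ≡.refl ; (suc i) → ≡.refl }) p))

  dependent-tail : ∀ {m k} (M : Fin m → Fin (suc k) → Carrier) → ColumnsDependent (λ i s → M i (suc s)) → ColumnsDependent M
  dependent-tail M (ν , rel , s₀ , νs₀≉0) = μ , rel′ , suc s₀ , νs₀≉0
    where
    μ : Fin _ → Carrier
    μ zero    = 0#
    μ (suc s) = ν s
    rel′ : IsColumnRelation M μ
    rel′ i = trans (+-congʳ (zeroˡ _)) (trans (+-identityˡ _) (rel i))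

  -- If the columns other than the first have a nonsingular maximal submatrix on rows `rows`, the
  -- cofactors along a new first row form the relation: Σ cofactor t * M i t is the maximal minor of
  -- M on rows i ◂ rows.  Otherwise those columns are already dependent.
  maximalMinors≈0⇒dependent : ∀ {k m} (M : Fin m → Fin (suc k) → Carrier) →
                              (∀ (rows : Fin (suc k) → Fin m) → det (λ i j → M (rows i) j) ≈ 0#) → ColumnsDependent M
  maximalMinors≈0⇒dependent {zero} M minors≈0 = (λ _ → 1#) , rel , zero , 1≉0
    where
    rel : IsColumnRelation M (λ _ → 1#)
    rel i = trans (+-identityʳ _) (trans (*-identityˡ _) (trans (sym (trans (+-identityʳ _) (*-identityʳ _))) (minors≈0 (λ _ → i))))
  maximalMinors≈0⇒dependent {suc k} {m} M minors≈0
    with any-function? (suc k) m (λ rows → ¬ det (λ r s → M (rows r) (suc s)) ≈ 0#)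
           (λ f g e nz z → nz (trans (det-cong (λ r s → reflexive (≡.cong (λ x → M x (suc s)) (e r)))) z))
           (λ rows → ¬? (det (λ r s → M (rows r) (suc s)) ≟ 0#))
  ... | no ¬nz = dependent-tail M (maximalMinors≈0⇒dependent (λ i s → M i (suc s))
                                     (λ rows → decidable-stable (_ ≟ 0#) (λ nz → ¬nz (rows , nz))))
  ... | yes (rows , nz) = cofactor , rel , zero , nz
    where
    cofactor : Fin (suc (suc k)) → Carrier
    cofactor t = signed (toℕ t) (det (λ r s → M (rows r) (punchIn t s)))
    rel : IsColumnRelation M cofactor
    rel i = trans (sum-cong-≋ {x = λ t → cofactor t * M i t} (λ t → trans (*-comm _ _) (sym (signed-*ˡ (toℕ t) _ _))))
                  (trans (reflexive (≡.sym (det-expansion (λ r j → M ((i ◂ rows) r) j)))) (minors≈0 (i ◂ rows)))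

  InSpan : ∀ {q m} → (Fin q → Fin m → Carrier) → (Fin m → Carrier) → Set (c ⊔ ℓ)
  InSpan {q} W v = ∃ λ (coeff : Fin q → Carrier) → ∀ i → v i ≈ sum (λ s → coeff s * W s i)

  inSpan-member : ∀ {q m} (W : Fin q → Fin m → Carrier) s → InSpan W (W s)
  inSpan-member W s = δ , λ i → sym (trans (sum-single (λ t → δ t * W t i) s (off i)) (trans (*-congʳ δ-diagonal) (*-identityˡ _)))
    where
    δ : Fin _ → Carrier
    δ t with t FinP.≟ s
    ... | yes _ = 1#
    ... | no _  = 0#
    off : ∀ i t → t ≢ s → δ t * W t i ≈ 0#
    off i t t≢s with t FinP.≟ s
    ... | yes t≡s = ⊥-elim (t≢s t≡s)
    ... | no _    = zeroˡ _
    δ-diagonal : δ s ≈ 1#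
    δ-diagonal with s FinP.≟ s
    ... | yes _   = refl
    ... | no s≢s = ⊥-elim (s≢s ≡.refl)

  private
    sum-swap : ∀ {p q} (a : Fin p → Carrier) (x : Fin p → Fin q → Carrier) (y : Fin q → Carrier) →
               sum (λ u → a u * sum (λ t → x u t * y t)) ≈ sum (λ t → sum (λ u → a u * x u t) * y t)
    sum-swap a x y = begin
      sum (λ u → a u * sum (λ t → x u t * y t))    ≈⟨ sum-cong-≋ {x = λ u → a u * sum (λ t → x u t * y t)} (λ u → *-distribˡ-sum (a u) (λ t → x u t * y t)) ⟩
      sum (λ u → sum (λ t → a u * (x u t * y t)))  ≈⟨ ∑-comm (λ u t → a u * (x u t * y t)) ⟩
      sum (λ t → sum (λ u → a u * (x u t * y t)))  ≈⟨ sum-cong-≋ {x = λ t → sum (λ u → a u * (x u t * y t))}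
                                                        (λ t → sum-cong-≋ {x = λ u → a u * (x u t * y t)} (λ u → sym (*-assoc _ _ _))) ⟩
      sum (λ t → sum (λ u → (a u * x u t) * y t))  ≈⟨ sum-cong-≋ {x = λ t → sum (λ u → a u * x u t) * y t} (λ t → *-distribʳ-sum (y t) (λ u → a u * x u t)) ⟨
      sum (λ t → sum (λ u → a u * x u t) * y t)    ∎

  inSpan-combination : ∀ {q r m} (W : Fin q → Fin m → Carrier) (V : Fin r → Fin m → Carrier) (cs : Fin r → Carrier) (u : Fin m → Carrier) →
                       (∀ t → InSpan W (V t)) → (∀ i → u i ≈ sum (λ t → cs t * V t i)) → InSpan W u
  inSpan-combination W V cs u inSpan u≈ = (λ s → sum (λ t → cs t * proj₁ (inSpan t) s)) , λ i → begin
    u i                                                       ≈⟨ u≈ i ⟩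
    sum (λ t → cs t * V t i)                                  ≈⟨ sum-cong-≋ {x = λ t → cs t * V t i} (λ t → *-congˡ (proj₂ (inSpan t) i)) ⟩
    sum (λ t → cs t * sum (λ s → proj₁ (inSpan t) s * W s i)) ≈⟨ sum-swap cs (λ t → proj₁ (inSpan t)) (λ s → W s i) ⟩
    sum (λ s → sum (λ t → cs t * proj₁ (inSpan t) s) * W s i) ∎

  inSpan-restrict : ∀ {q m m′} (W : Fin q → Fin m → Carrier) v (f : Fin m′ → Fin m) → InSpan W v → InSpan (λ s i → W s (f i)) (v ∘ f)
  inSpan-restrict W v f (coeff , v≈) = coeff , v≈ ∘ f

  columnRelation-inSpan : ∀ {q m k} (N : Fin q → Fin k → Carrier) (M : Fin m → Fin k → Carrier) μ →
                          IsColumnRelation N μ → (∀ i → InSpan N (M i)) → IsColumnRelation M μ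
  columnRelation-inSpan N M μ rel inSpan i = begin
    sum (λ t → μ t * M i t)                                 ≈⟨ sum-cong-≋ {x = λ t → μ t * M i t} (λ t → *-congˡ (trans (proj₂ (inSpan i) t)
                                                                  (sum-cong-≋ {x = λ s → coeff s * N s t} (λ s → *-comm _ _)))) ⟩
    sum (λ t → μ t * sum (λ s → N s t * coeff s))           ≈⟨ sum-swap μ (λ t s → N s t) coeff ⟩
    sum (λ s → sum (λ t → μ t * N s t) * coeff s)           ≈⟨ sum-0# _ (λ s → trans (*-congʳ (rel s)) (zeroˡ _)) ⟩
    0#                                                      ∎
    where coeff = proj₁ (inSpan i)

  columnsInSmallerSpan⇒det≈0 : ∀ {k p} → p ℕ.< k → (N : Matrix k) (W : Fin p → Fin k → Carrier) →
                               (∀ j → InSpan W (λ i → N i j)) → det N ≈ 0#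
  columnsInSmallerSpan⇒det≈0 p<k N W inSpan with wide⇒dependent p<k (λ s j → proj₁ (inSpan j) s)
  ... | ν , rel , nz = dependent⇒det≈0 N (ν , columnRelation-inSpan _ N ν rel rows , nz)
    where
    rows : ∀ i → InSpan (λ s j → proj₁ (inSpan j) s) (N i)
    rows i = (λ s → W s i) , λ j → trans (proj₂ (inSpan j) i) (sum-cong-≋ {x = λ s → proj₁ (inSpan j) s * W s i} (λ s → *-comm _ _))

_ᵀ : ∀ {a} {A : Set a} {m k} → (Fin m → Fin k → A) → Fin k → Fin m → A
(M ᵀ) j i = M i j

IsNearSemiringEndomorphism : ∀ {c ℓ} (R : CommutativeRing c ℓ) → (CommutativeRing.Carrier R → CommutativeRing.Carrier R) → Set (c ⊔ ℓ)
IsNearSemiringEndomorphism R = IsNearSemiringHomomorphism raw raw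
  where raw = NearSemiring.rawNearSemiring (CommutativeRing.nearSemiring R)

module ShiftInvariant {c ℓ} (R : CommutativeRing c ℓ) (F : IsDiscreteField R)
  (σ : CommutativeRing.Carrier R → CommutativeRing.Carrier R)
  (σ-homo : IsNearSemiringEndomorphism R σ)
  {n : ℕ} (next prev : Fin n → Fin n)
  (next-suc : ∀ j → suc (toℕ j) ℕ.< n → toℕ (next j) ≡ suc (toℕ j))
  (next-prev : ∀ i → next (prev i) ≡ i) where
  open CommutativeRing R hiding (zero)
  open IsNearSemiringHomomorphism σ-homo using (⟦⟧-cong; +-homo; 0#-homo; *-homo)
  open IsDiscreteField F
  open Determinant R
  open LinearAlgebra R F
  open import Algebra.Properties.Ring ring using (-‿distribˡ-*; -‿distribʳ-*; +-inverseʳ-unique)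
  open import Algebra.Properties.Monoid.Sum +-monoid using (sum-init-last)
  open import Relation.Nullary.Decidable using (decidable-stable)
  open import Relation.Binary.Reasoning.Setoid setoid

  σ-sum : ∀ {k} (f : Fin k → Carrier) → σ (sum f) ≈ sum (σ ∘ f)
  σ-sum {zero}  f = 0#-homo
  σ-sum {suc k} f = trans (+-homo _ _) (+-congˡ (σ-sum (f ∘ suc)))

  IsShiftInvariant : Matrix n → Set ℓ
  IsShiftInvariant M = ∀ i j → σ (M i j) ≈ M (next i) (next j)

  firstColumns : ∀ {k} (M : Matrix n) → .(k ℕ.≤ n) → Fin k → Fin n → Carrier
  firstColumns M k≤n s = (M ᵀ) (Fin.inject≤ s k≤n)

  inSpan-firstColumns : ∀ {k} (M : Matrix n) .(k≤n : k ℕ.≤ n) j → toℕ j ℕ.< k → InSpan (firstColumns M k≤n) ((M ᵀ) j)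
  inSpan-firstColumns M k≤n j j<k = ≡.subst (InSpan (firstColumns M k≤n) ∘ (M ᵀ))
    (FinP.toℕ-injective (≡.trans (FinP.toℕ-inject≤ _ k≤n) (FinP.toℕ-fromℕ< j<k))) (inSpan-member (firstColumns M k≤n) (Fin.fromℕ< j<k))

  module _ (M : Matrix n) (shift : IsShiftInvariant M) where

    -- Applying σ to the relation for column y expresses column y + 1 through the columns 1, …, p,
    -- which lie in the span of the first p columns by hypothesis.
    nextColumn⇒allColumnsInSpan : ∀ p (p<n : p ℕ.< n) → InSpan (firstColumns M (ℕP.<⇒≤ p<n)) ((M ᵀ) (Fin.fromℕ< p<n)) →
                                  ∀ j → InSpan (firstColumns M (ℕP.<⇒≤ p<n)) ((M ᵀ) j)
    nextColumn⇒allColumnsInSpan p p<n inSpan-p j = inSpan-all (toℕ j) j ≡.refl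
      where
      W = firstColumns M (ℕP.<⇒≤ p<n)
      inSpan-upTo : ∀ j → toℕ j ℕ.≤ p → InSpan W ((M ᵀ) j)
      inSpan-upTo j j≤p with toℕ j ℕ.<? p
      ... | yes j<p = inSpan-firstColumns M (ℕP.<⇒≤ p<n) j j<p
      ... | no j≮p  = ≡.subst (InSpan W ∘ (M ᵀ)) (FinP.toℕ-injective (≡.trans (FinP.toℕ-fromℕ< p<n) (ℕP.≤-antisym (ℕP.≮⇒≥ j≮p) j≤p))) inSpan-p
      inSpan-all : ∀ y j → toℕ j ≡ y → InSpan W ((M ᵀ) j)
      inSpan-all zero    j j≡0 = inSpan-upTo j (ℕP.≤-trans (ℕP.≤-reflexive j≡0) ℕ.z≤n)
      inSpan-all (suc y) j j≡1+y with toℕ j ℕ.≤? p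
      ... | yes j≤p = inSpan-upTo j j≤p
      ... | no j≰p  = inSpan-combination W (λ s → (M ᵀ) (next (lead s))) (σ ∘ coeff) ((M ᵀ) j) shiftedInSpan shifted
        where
        y<n : y ℕ.< n
        y<n = ℕP.<-trans (ℕP.n<1+n y) (≡.subst (ℕ._< n) j≡1+y (FinP.toℕ<n j))
        j′ = Fin.fromℕ< y<n
        j′≡y = FinP.toℕ-fromℕ< y<n
        next-j′ : next j′ ≡ j
        next-j′ = FinP.toℕ-injective (≡.trans (next-suc j′ (≡.subst (λ x → suc x ℕ.< n) (≡.sym j′≡y) (≡.subst (ℕ._< n) j≡1+y (FinP.toℕ<n j))))
                                     (≡.trans (≡.cong suc j′≡y) (≡.sym j≡1+y)))
        lead : Fin p → Fin n
        lead s = Fin.inject≤ s (ℕP.<⇒≤ p<n)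
        coeff = proj₁ (inSpan-all y j′ j′≡y)
        shiftedInSpan : ∀ s → InSpan W ((M ᵀ) (next (lead s)))
        shiftedInSpan s = inSpan-upTo (next (lead s)) (ℕP.≤-trans (ℕP.≤-reflexive (next-suc (lead s) lead<)) (ℕP.≤-trans (ℕ.s≤s (ℕP.≤-reflexive (FinP.toℕ-inject≤ s _))) (FinP.toℕ<n s)))
          where
          lead< : suc (toℕ (lead s)) ℕ.< n
          lead< = ≡.subst (λ x → suc x ℕ.< n) (≡.sym (FinP.toℕ-inject≤ s _)) (ℕP.<-≤-trans (ℕ.s≤s (FinP.toℕ<n s)) p<n)
        shifted : ∀ i → M i j ≈ sum (λ s → σ (coeff s) * M i (next (lead s)))
        shifted i = begin
          M i j                                                ≡⟨ ≡.cong₂ M (≡.sym (next-prev i)) (≡.sym next-j′) ⟩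
          M (next (prev i)) (next j′)                          ≈⟨ shift (prev i) j′ ⟨
          σ (M (prev i) j′)                                    ≈⟨ ⟦⟧-cong (proj₂ (inSpan-all y j′ j′≡y) (prev i)) ⟩
          σ (sum (λ s → coeff s * M (prev i) (lead s)))        ≈⟨ σ-sum (λ s → coeff s * M (prev i) (lead s)) ⟩
          sum (λ s → σ (coeff s * M (prev i) (lead s)))        ≈⟨ sum-cong-≋ {x = λ s → σ (coeff s * M (prev i) (lead s))}
                                                                    (λ s → trans (*-homo _ _) (*-congˡ (shift _ _))) ⟩
          sum (λ s → σ (coeff s) * M (next (prev i)) (next (lead s))) ≡⟨ ≡.cong (λ i → sum (λ s → σ (coeff s) * M i (next (lead s)))) (next-prev i) ⟩
          sum (λ s → σ (coeff s) * M i (next (lead s)))        ∎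

    private
      inject≤-inject₁ : ∀ {p} (s : Fin p) .(le : suc p ℕ.≤ n) .(le′ : p ℕ.≤ n) → Fin.inject≤ (Fin.inject₁ s) le ≡ Fin.inject≤ s le′
      inject≤-inject₁ s le le′ = FinP.toℕ-injective (≡.trans (FinP.toℕ-inject≤ _ le) (≡.trans (FinP.toℕ-inject₁ s) (≡.sym (FinP.toℕ-inject≤ s le′))))

    -- Either the last coefficient of the relation vanishes, and it is a relation among the first p
    -- columns, or column p is a combination of the earlier ones.
    dependent⇒allColumnsInSpan : ∀ p (p<n : p ℕ.< n) → ColumnsDependent (λ i t → M i (Fin.inject≤ t p<n)) →
                                 ∀ j → InSpan (firstColumns M (ℕP.<⇒≤ p<n)) ((M ᵀ) j)
    dependent⇒allColumnsInSpan p p<n (μ , rel , t₀ , μt₀≉0) j with μ (Fin.fromℕ p) ≟ 0#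
    ... | no μp≉0 = nextColumn⇒allColumnsInSpan p p<n ((λ s → - w * μ (Fin.inject₁ s)) , lastColumn) j
      where
      open Σ (inverse _ μp≉0) renaming (proj₁ to w; proj₂ to μp*w≈1)
      lastColumn : ∀ i → M i (Fin.fromℕ< p<n) ≈ sum (λ s → (- w * μ (Fin.inject₁ s)) * M i (Fin.inject≤ s (ℕP.<⇒≤ p<n)))
      lastColumn i = begin
        last                                     ≈⟨ *-identityˡ _ ⟨
        1# * last                                ≈⟨ *-congʳ (trans (*-comm _ _) μp*w≈1) ⟨
        (w * μ (Fin.fromℕ p)) * last             ≈⟨ *-assoc _ _ _ ⟩
        w * (μ (Fin.fromℕ p) * last)             ≈⟨ *-congˡ (+-inverseʳ-unique _ _ split) ⟩
        w * - sum (λ s → μ (Fin.inject₁ s) * M i (lead s)) ≈⟨ -‿distribʳ-* _ _ ⟨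
        - (w * sum (λ s → μ (Fin.inject₁ s) * M i (lead s))) ≈⟨ -‿distribˡ-* _ _ ⟩
        - w * sum (λ s → μ (Fin.inject₁ s) * M i (lead s))   ≈⟨ *-distribˡ-sum (- w) (λ s → μ (Fin.inject₁ s) * M i (lead s)) ⟩
        sum (λ s → - w * (μ (Fin.inject₁ s) * M i (lead s))) ≈⟨ sum-cong-≋ {x = λ s → - w * (μ (Fin.inject₁ s) * M i (lead s))} (λ s → sym (*-assoc _ _ _)) ⟩
        sum (λ s → (- w * μ (Fin.inject₁ s)) * M i (lead s)) ∎
        where
        lead : Fin p → Fin n
        lead s = Fin.inject≤ s (ℕP.<⇒≤ p<n)
        last = M i (Fin.fromℕ< p<n)
        split : sum (λ s → μ (Fin.inject₁ s) * M i (lead s)) + μ (Fin.fromℕ p) * last ≈ 0#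
        split = trans (sym (trans (sum-init-last (λ t → μ t * M i (Fin.inject≤ t p<n))) (+-cong
                  (sum-cong-≋ {x = λ s → μ (Fin.inject₁ s) * M i (Fin.inject≤ (Fin.inject₁ s) p<n)}
                    (λ s → reflexive (≡.cong (λ j → μ (Fin.inject₁ s) * M i j) (inject≤-inject₁ s p<n (ℕP.<⇒≤ p<n)))))
                  (reflexive (≡.cong (λ j → μ (Fin.fromℕ p) * M i j) (FinP.toℕ-injective (≡.trans (FinP.toℕ-inject≤ _ p<n)
                    (≡.trans (FinP.toℕ-fromℕ p) (≡.sym (FinP.toℕ-fromℕ< p<n)))))))))) (rel i)
    dependent⇒allColumnsInSpan zero    p<n (μ , rel , zero , μ0≉0) j | yes μ0≈0 = ⊥-elim (μ0≉0 μ0≈0)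
    dependent⇒allColumnsInSpan (suc p) p<n (μ , rel , t₀ , μt₀≉0) j | yes μp≈0 =
      inSpan-combination W (firstColumns M p≤n) coeff ((M ᵀ) j) widen (proj₂ inSpan-p)
      where
      p≤n = ℕP.<⇒≤ (ℕP.<⇒≤ p<n)
      W = firstColumns M (ℕP.<⇒≤ p<n)
      t₀≢last : suc p ≢ toℕ t₀
      t₀≢last e = μt₀≉0 (trans (reflexive (≡.cong μ (FinP.toℕ-injective (≡.trans (≡.sym e) (≡.sym (FinP.toℕ-fromℕ (suc p))))))) μp≈0)
      rel′ : IsColumnRelation (λ i t → M i (Fin.inject≤ t (ℕP.<⇒≤ p<n))) (μ ∘ Fin.inject₁)
      rel′ i = begin
        sum (λ t → μ (Fin.inject₁ t) * M i (Fin.inject≤ t (ℕP.<⇒≤ p<n)))            ≈⟨ +-identityʳ _ ⟨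
        sum (λ t → μ (Fin.inject₁ t) * M i (Fin.inject≤ t (ℕP.<⇒≤ p<n))) + 0#       ≈⟨ +-cong
            (sum-cong-≋ {x = λ t → μ (Fin.inject₁ t) * M i (Fin.inject≤ t (ℕP.<⇒≤ p<n))}
              (λ t → reflexive (≡.cong (λ j → μ (Fin.inject₁ t) * M i j) (≡.sym (inject≤-inject₁ t p<n (ℕP.<⇒≤ p<n))))))
            (sym (trans (*-congʳ μp≈0) (zeroˡ _))) ⟩
        sum (λ t → μ (Fin.inject₁ t) * M i (Fin.inject≤ (Fin.inject₁ t) p<n)) + μ (Fin.fromℕ (suc p)) * M i (Fin.inject≤ (Fin.fromℕ (suc p)) p<n)
                                                                                    ≈⟨ sum-init-last (λ t → μ t * M i (Fin.inject≤ t p<n)) ⟨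
        sum (λ t → μ t * M i (Fin.inject≤ t p<n))                                   ≈⟨ rel i ⟩
        0#                                                                          ∎
      inSpan-p = dependent⇒allColumnsInSpan p (ℕP.<⇒≤ p<n)
                   (μ ∘ Fin.inject₁ , rel′ , Fin.lower₁ t₀ t₀≢last , λ e → μt₀≉0 (trans (reflexive (≡.cong μ (≡.sym (FinP.inject₁-lower₁ t₀ t₀≢last)))) e)) j
      coeff = proj₁ inSpan-p
      widen : ∀ s → InSpan W (firstColumns M p≤n s)
      widen s = ≡.subst (InSpan W ∘ (M ᵀ)) (inject≤-inject₁ s (ℕP.<⇒≤ p<n) p≤n) (inSpan-member W (Fin.inject₁ s))

  -- Every column is a combination of the first r columns and every row of the first r rows, so a
  -- relation among the columns of the leading block extends to the first r columns of A, and then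
  -- every column lies in the span of r − 1 columns, which kills all r × r minors.
  leadingPrincipalMinor≉0 : ∀ (A : Matrix n) → IsShiftInvariant A → ∀ r → Over.IsRank R A r → (r≤n : r ℕ.≤ n) →
                            ¬ det (λ i j → A (Fin.inject≤ i r≤n) (Fin.inject≤ j r≤n)) ≈ 0#
  leadingPrincipalMinor≉0 A shiftA zero    _                                  _   det≈0 = 1≉0 det≈0
  leadingPrincipalMinor≉0 A shiftA (suc p) ((rows , cols , minor≉0) , maximal) r≤n det≈0 =
    minor≉0 (columnsInSmallerSpan⇒det≈0 (ℕP.n<1+n p) (λ i j → A (rows i) (cols j)) (λ s i → A (rows i) (Fin.inject≤ s (ℕP.<⇒≤ r≤n)))
              (λ j → inSpan-restrict (firstColumns A (ℕP.<⇒≤ r≤n)) ((A ᵀ) (cols j)) rows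
                       (dependent⇒allColumnsInSpan A shiftA p r≤n leadingColumnsDependent (cols j))))
    where
    r = suc p
    E : Fin r → Fin n
    E t = Fin.inject≤ t r≤n
    columnsInSpan : ∀ j → InSpan (firstColumns A r≤n) ((A ᵀ) j)
    columnsInSpan j with r ℕ.<? n
    ... | no r≮n  = inSpan-firstColumns A r≤n j (ℕP.<-≤-trans (FinP.toℕ<n j) (ℕP.≮⇒≥ r≮n))
    ... | yes r<n = dependent⇒allColumnsInSpan A shiftA r r<n (maximalMinors≈0⇒dependent (λ i t → A i (Fin.inject≤ t r<n)) minors≈0) j
      where
      minors≈0 : ∀ rows′ → det (λ i t → A (rows′ i) (Fin.inject≤ t r<n)) ≈ 0#
      minors≈0 rows′ = decidable-stable (_ ≟ 0#) (λ nz → ℕP.1+n≰n (maximal (suc r) (rows′ , (λ t → Fin.inject≤ t r<n) , nz)))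
    -- The first r + 1 rows are dependent on the first r columns, hence on all columns.
    rowsInSpan : ∀ i → InSpan (firstColumns (A ᵀ) r≤n) (A i)
    rowsInSpan i with r ℕ.<? n
    ... | no r≮n  = inSpan-firstColumns (A ᵀ) r≤n i (ℕP.<-≤-trans (FinP.toℕ<n i) (ℕP.≮⇒≥ r≮n))
    ... | yes r<n with wide⇒dependent (ℕP.n<1+n r) (λ t u → A (Fin.inject≤ u r<n) (E t))
    ...   | ν , rel , ν≉0 = dependent⇒allColumnsInSpan (A ᵀ) (λ i j → shiftA j i) r r<n (ν , relᵀ , ν≉0) i
      where
      relᵀ : IsColumnRelation (λ j u → A (Fin.inject≤ u r<n) j) ν
      relᵀ = columnRelation-inSpan (λ t u → A (Fin.inject≤ u r<n) (E t)) (λ j u → A (Fin.inject≤ u r<n) j) ν rel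
               (λ j → inSpan-restrict (λ s i → A i (E s)) ((A ᵀ) j) (λ u → Fin.inject≤ u r<n) (columnsInSpan j))
    leadingColumnsDependent : ColumnsDependent (λ i t → A i (E t))
    leadingColumnsDependent with det≈0⇒dependent (λ u t → A (E u) (E t)) det≈0
    ... | μ , rel , μ≉0 = μ , columnRelation-inSpan (λ u t → A (E u) (E t)) (λ i t → A i (E t)) μ rel
                                (λ i → inSpan-restrict (λ s j → A (E s) j) (A i) E (rowsInSpan i)) , μ≉0

module _ {p : ℕ} (prime : Prime p) where
  open import Data.Nat.Divisibility using (_∣_; ∣1⇒≡1; ∣⇒≤; m∣m*n)
  open import Data.Nat.Combinatorics using (_C_; k![n∸k]!∣n!; nCk≡n!/k![n-k]!)
  open import Data.Nat.Base using (_!)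
  open import Data.Nat.DivMod using (m/n*n≡m)

  private
    1<p : 1 ℕ.< p
    1<p = ℕ.nonTrivial⇒n>1 p {{prime⇒nonTrivial prime}}

    prime∤! : ∀ m → m ℕ.< p → ¬ p ∣ m !
    prime∤! zero    _   p∣1 = ℕP.<-irrefl (≡.sym (∣1⇒≡1 p∣1)) 1<p
    prime∤! (suc m) m<p p∣m! with euclidsLemma (suc m) (m !) prime p∣m!
    ... | inj₁ p∣1+m = ℕP.<-irrefl ≡.refl (ℕP.≤-<-trans (∣⇒≤ p∣1+m) m<p)
    ... | inj₂ p∣m!  = prime∤! m (ℕP.<-trans (ℕP.n<1+n m) m<p) p∣m!

  prime∣choose : ∀ k → 0 ℕ.< k → k ℕ.< p → p ∣ p C k
  prime∣choose k 0<k k<p with euclidsLemma (p C k) (k ! ℕ.* (p ℕ.∸ k) !) prime p∣product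
    where
    instance _ = ℕP._!*_!≢0 k (p ℕ.∸ k)
    p∣product : p ∣ (p C k) ℕ.* (k ! ℕ.* (p ℕ.∸ k) !)
    p∣product = ≡.subst (p ∣_) (≡.sym (≡.trans (≡.cong (ℕ._* (k ! ℕ.* (p ℕ.∸ k) !)) (nCk≡n!/k![n-k]! (ℕP.<⇒≤ k<p))) (m/n*n≡m (k![n∸k]!∣n! (ℕP.<⇒≤ k<p)))))
                  (p∣p! p 1<p)
      where
      p∣p! : ∀ n → 1 ℕ.< n → n ∣ n !
      p∣p! (suc n) _ = m∣m*n (n !)
  ... | inj₁ p∣choose = p∣choose
  ... | inj₂ p∣k!*[p-k]! with euclidsLemma (k !) ((p ℕ.∸ k) !) prime p∣k!*[p-k]!
  ...   | inj₁ p∣k!     = ⊥-elim (prime∤! k k<p p∣k!)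
  ...   | inj₂ p∣[p-k]! = ⊥-elim (prime∤! (p ℕ.∸ k) (ℕP.∸-monoʳ-< 0<k (ℕP.<⇒≤ k<p)) p∣[p-k]!)

module Frobenius {c ℓ} (R : CommutativeRing c ℓ) {p : ℕ} (prime : Prime p) where
  open CommutativeRing R hiding (zero)
  open import Algebra.Properties.Semiring.Exp semiring using (_^_; ^-congˡ; ^-assocʳ)
  open import Algebra.Properties.Semiring.Mult semiring renaming (_×_ to _·_) using (×-congʳ; ×-assoc-*; ×1-homo-*)
  open import Algebra.Properties.CommutativeSemiring.Binomial commutativeSemiring using (theorem; binomialTerm)
  open import Algebra.Properties.CommutativeSemiring.Exp commutativeSemiring using (^-distrib-*)
  open import Algebra.Properties.Ring ring using (x+x≈x⇒x≈0)
  open import Algebra.Properties.Semiring.Sum semiring using (sum)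
  open import Data.Nat.Combinatorics using (_C_; nCn≡1)
  open import Data.Nat.Divisibility using (divides)
  open SparseSums +-commutativeMonoid using (sum-pair)
  open import Relation.Binary.Reasoning.Setoid setoid

  module _ (p·1≈0 : p · 1# ≈ 0#) where

    frobenius-+ : ∀ x y → (x + y) ^ p ≈ x ^ p + y ^ p
    frobenius-+ x y = begin
      (x + y) ^ p                                              ≈⟨ theorem p x y ⟩
      sum (binomialTerm x y p)                                 ≈⟨ sum-pair (binomialTerm x y p) zero (Fin.fromℕ p) 0≢p inner≈0 ⟩
      binomialTerm x y p zero + binomialTerm x y p (Fin.fromℕ p) ≈⟨ +-cong (trans (+-identityʳ _) (*-identityˡ _)) top ⟩
      y ^ p + x ^ p                                            ≈⟨ +-comm _ _ ⟩
      x ^ p + y ^ p                                            ∎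
      where
      0≢p : zero ≢ Fin.fromℕ p
      0≢p e = ℕP.<-irrefl (≡.trans (≡.cong toℕ e) (FinP.toℕ-fromℕ p)) (ℕP.<-trans ℕP.0<1+n (ℕ.nonTrivial⇒n>1 p {{prime⇒nonTrivial prime}}))
      inner≈0 : ∀ t → t ≢ zero → t ≢ Fin.fromℕ p → binomialTerm x y p t ≈ 0#
      inner≈0 t t≢0 t≢p with prime∣choose prime (toℕ t) 0<t t<p
        where
        0<t = ℕP.n≢0⇒n>0 (λ e → t≢0 (FinP.toℕ-injective e))
        t<p = ℕP.≤∧≢⇒< (ℕP.≤-pred (FinP.toℕ<n t)) (λ e → t≢p (FinP.toℕ-injective (≡.trans e (≡.sym (FinP.toℕ-fromℕ p)))))
      ... | divides d choose≡d*p = begin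
        (p C toℕ t) · z                   ≡⟨ ≡.cong (_· z) choose≡d*p ⟩
        (d ℕ.* p) · z                     ≈⟨ ×-congʳ (d ℕ.* p) (*-identityˡ z) ⟨
        (d ℕ.* p) · (1# * z)              ≈⟨ ×-assoc-* (d ℕ.* p) 1# z ⟨
        ((d ℕ.* p) · 1#) * z              ≈⟨ *-congʳ (×1-homo-* d p) ⟩
        ((d · 1#) * (p · 1#)) * z         ≈⟨ *-congʳ (trans (*-congˡ p·1≈0) (zeroʳ _)) ⟩
        0# * z                            ≈⟨ zeroˡ z ⟩
        0#                                ∎
        where z = x ^ toℕ t * y ^ (p ℕ.∸ toℕ t)
      top : binomialTerm x y p (Fin.fromℕ p) ≈ x ^ p
      top = begin
        (p C toℕ (Fin.fromℕ p)) · (x ^ toℕ (Fin.fromℕ p) * y ^ (p ℕ.∸ toℕ (Fin.fromℕ p)))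
                                          ≡⟨ ≡.cong (λ k → (p C k) · (x ^ k * y ^ (p ℕ.∸ k))) (FinP.toℕ-fromℕ p) ⟩
        (p C p) · (x ^ p * y ^ (p ℕ.∸ p)) ≡⟨ ≡.cong₂ (λ a b → a · (x ^ p * y ^ b)) (nCn≡1 p) (ℕP.n∸n≡0 p) ⟩
        x ^ p * 1# + 0#                   ≈⟨ trans (+-identityʳ _) (*-identityʳ _) ⟩
        x ^ p                             ∎

    frobenius-+-iterate : ∀ k x y → (x + y) ^ (p ℕ.^ k) ≈ x ^ (p ℕ.^ k) + y ^ (p ℕ.^ k)
    frobenius-+-iterate zero    x y = trans (*-identityʳ _) (sym (+-cong (*-identityʳ _) (*-identityʳ _)))
    frobenius-+-iterate (suc k) x y = begin
      (x + y) ^ (p ℕ.* p ℕ.^ k)                      ≈⟨ ^-assocʳ (x + y) p (p ℕ.^ k) ⟨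
      ((x + y) ^ p) ^ (p ℕ.^ k)                      ≈⟨ ^-congˡ (p ℕ.^ k) (frobenius-+ x y) ⟩
      (x ^ p + y ^ p) ^ (p ℕ.^ k)                    ≈⟨ frobenius-+-iterate k (x ^ p) (y ^ p) ⟩
      (x ^ p) ^ (p ℕ.^ k) + (y ^ p) ^ (p ℕ.^ k)      ≈⟨ +-cong (^-assocʳ x p (p ℕ.^ k)) (^-assocʳ y p (p ℕ.^ k)) ⟩
      x ^ (p ℕ.* p ℕ.^ k) + y ^ (p ℕ.* p ℕ.^ k)      ∎

    frobenius-endomorphism : ∀ k → IsNearSemiringEndomorphism R (_^ (p ℕ.^ k))
    frobenius-endomorphism k = record
      { +-isMonoidHomomorphism = record
        { isMagmaHomomorphism = record
          { isRelHomomorphism = record { cong = ^-congˡ (p ℕ.^ k) }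
          ; homo              = frobenius-+-iterate k
          }
        ; ε-homo = x+x≈x⇒x≈0 _ (trans (sym (frobenius-+-iterate k 0# 0#)) (^-congˡ (p ℕ.^ k) (+-identityˡ 0#)))
        }
      ; *-homo = λ x y → ^-distrib-* x y (p ℕ.^ k)
      }

module FiniteField {c ℓ} (R : CommutativeRing c ℓ) {N : ℕ} (F : Over.IsFiniteFieldOfOrder R N) where
  open CommutativeRing R hiding (zero)
  open Over.IsFiniteFieldOfOrder F
  open import Data.List using (length; lookup)
  open import Data.List.Relation.Unary.All using (All; _∷_)
  open import Data.List.Relation.Unary.AllPairs using (AllPairs; _∷_)
  import Data.List.Relation.Unary.Any as Any
  open import Data.List.Relation.Unary.Any.Properties using (lookup-index)
  open import Data.Fin.Permutation using (permutation)
  import Algebra.Properties.CommutativeMonoid.Sum as CommutativeMonoidSum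
  import Algebra.Properties.Monoid.Sum as MonoidSum
  open import Relation.Nullary.Decidable using (map′)
  open import Algebra.Properties.Ring ring using (+-identityʳ-unique)
  open import Algebra.Properties.Semiring.Exp semiring using (_^_; ^-congˡ)
  open import Algebra.Properties.Semiring.Mult semiring renaming (_×_ to _·_) using (×1-homo-*)
  open import Relation.Binary.Reasoning.Setoid setoid

  private
    L = length elements

    element : Fin L → Carrier
    element = lookup elements

    index : Carrier → Fin L
    index x = Any.index (complete x)

    element-index : ∀ x → x ≈ element (index x)
    element-index x = lookup-index (complete x)

    all-lookup : ∀ {P : Carrier → Set ℓ} {xs} → All P xs → ∀ i → P (lookup xs i)
    all-lookup (px ∷ _)   zero    = px
    all-lookup (_  ∷ pxs) (suc i) = all-lookup pxs i

    lookup-injective : ∀ {xs} → AllPairs (λ a b → ¬ a ≈ b) xs → ∀ i j → lookup xs i ≈ lookup xs j → i ≡ j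
    lookup-injective (_  ∷ _)  zero    zero    _ = ≡.refl
    lookup-injective (x≉ ∷ _)  zero    (suc j) e = ⊥-elim (all-lookup x≉ j e)
    lookup-injective (x≉ ∷ _)  (suc i) zero    e = ⊥-elim (all-lookup x≉ i (sym e))
    lookup-injective (_  ∷ xs≉) (suc i) (suc j) e = ≡.cong suc (lookup-injective xs≉ i j e)

    index-cong : ∀ {x y} → x ≈ y → index x ≡ index y
    index-cong {x} {y} x≈y = lookup-injective distinct _ _ (trans (sym (element-index x)) (trans x≈y (element-index y)))

    index-element : ∀ i → index (element i) ≡ i
    index-element i = lookup-injective distinct _ _ (sym (element-index (element i)))

  infix 4 _≟_
  _≟_ : ∀ x y → Dec (x ≈ y)
  x ≟ y = map′ (λ e → trans (element-index x) (trans (reflexive (≡.cong element e)) (sym (element-index y)))) index-cong (index x FinP.≟ index y)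

  isDiscreteField : IsDiscreteField R
  isDiscreteField = record { _≟_ = _≟_ ; 1≉0 = nontrivial ; inverse = inverse }

  private
    module _ {a ℓ′} (M : CommutativeMonoid a ℓ′) where
      open CommutativeMonoid M using () renaming (Carrier to A; _≈_ to _≈ᴹ_; trans to transᴹ)
      open CommutativeMonoidSum M using (sum; sum-permute; sum-cong-≋)

      sum-bijection : (f : Carrier → A) → (∀ {x y} → x ≈ y → f x ≈ᴹ f y) →
                      (τ τ⁻¹ : Carrier → Carrier) → (∀ {x y} → x ≈ y → τ x ≈ τ y) → (∀ {x y} → x ≈ y → τ⁻¹ x ≈ τ⁻¹ y) →
                      (∀ x → τ (τ⁻¹ x) ≈ x) → (∀ x → τ⁻¹ (τ x) ≈ x) → sum (f ∘ element) ≈ᴹ sum (f ∘ τ ∘ element)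
      sum-bijection f f-cong τ τ⁻¹ τ-cong τ⁻¹-cong ττ⁻¹ τ⁻¹τ =
        transᴹ (sum-permute (f ∘ element) π) (sum-cong-≋ {x = λ i → f (element (index (τ (element i))))} (λ i → f-cong (sym (element-index _))))
        where
        π = permutation (λ i → index (τ (element i))) (λ i → index (τ⁻¹ (element i)))
              (λ i → ≡.trans (index-cong (trans (τ-cong (sym (element-index _))) (ττ⁻¹ _))) (index-element i))
              (λ i → ≡.trans (index-cong (trans (τ⁻¹-cong (sym (element-index _))) (τ⁻¹τ _))) (index-element i))

  open LinearAlgebra R isDiscreteField using (x*y≈0⇒y≈0)

  private
    module Σ+ = CommutativeMonoidSum +-commutativeMonoid
    module Π* = CommutativeMonoidSum *-commutativeMonoid
    module Σ+′ = MonoidSum +-monoid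
    module Π*′ = MonoidSum *-monoid

  -- y ↦ y + 1 permutes the field, so Σ y = Σ (y + 1) = Σ y + N · 1.
  N·1≈0 : N · 1# ≈ 0#
  N·1≈0 = +-identityʳ-unique S (N · 1#) (begin
    S + N · 1#                  ≡⟨ ≡.cong (λ n → S + n · 1#) (≡.sym card) ⟩
    S + L · 1#                  ≈⟨ +-congˡ (Σ+′.sum-replicate L) ⟨
    S + Σ+.sum {L} (λ _ → 1#)   ≈⟨ Σ+.∑-distrib-+ element (λ _ → 1#) ⟨
    Σ+.sum (λ i → element i + 1#) ≈⟨ sum-bijection +-commutativeMonoid id id (_+ 1#) (_- 1#) +-congʳ +-congʳ shift-back shift-forth ⟨
    S                           ∎)
    where
    S = Σ+.sum element
    shift-back : ∀ x → (x - 1#) + 1# ≈ x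
    shift-back x = trans (+-assoc _ _ _) (trans (+-congˡ (-‿inverseˡ _)) (+-identityʳ _))
    shift-forth : ∀ x → (x + 1#) - 1# ≈ x
    shift-forth x = trans (+-assoc _ _ _) (trans (+-congˡ (-‿inverseʳ _)) (+-identityʳ _))

  private
    ^≈0⇒≈0 : ∀ x e → x ^ e ≈ 0# → x ≈ 0#
    ^≈0⇒≈0 x zero    1≈0 = ⊥-elim (nontrivial 1≈0)
    ^≈0⇒≈0 x (suc e) xxᵉ≈0 with x ≟ 0#
    ... | yes x≈0 = x≈0
    ... | no x≉0  = ^≈0⇒≈0 x e (x*y≈0⇒y≈0 x≉0 xxᵉ≈0)

    ^·1 : ∀ p e → (p ℕ.^ e) · 1# ≈ (p · 1#) ^ e
    ^·1 p zero    = +-identityʳ 1#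
    ^·1 p (suc e) = trans (×1-homo-* p (p ℕ.^ e)) (*-congˡ (^·1 p e))

  characteristic : ∀ {p} e → N ≡ p ℕ.^ e → p · 1# ≈ 0#
  characteristic {p} e N≡pᵉ = ^≈0⇒≈0 (p · 1#) e (trans (sym (^·1 p e)) (trans (reflexive (≡.cong (_· 1#) (≡.sym N≡pᵉ))) N·1≈0))

  private
    product≉0 : ∀ {k} (f : Fin k → Carrier) → (∀ i → ¬ f i ≈ 0#) → ¬ Π*.sum f ≈ 0#
    product≉0 {zero}  f f≉0 = nontrivial
    product≉0 {suc k} f f≉0 Πf≈0 = product≉0 (f ∘ suc) (f≉0 ∘ suc) (x*y≈0⇒y≈0 (f≉0 zero) Πf≈0)

    *-cancelˡ : ∀ {x a b} → ¬ x ≈ 0# → x * a ≈ x * b → a ≈ b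
    *-cancelˡ {x} {a} {b} x≉0 xa≈xb = begin
      a                 ≈⟨ *-identityˡ a ⟨
      1# * a            ≈⟨ *-congʳ (trans (*-comm _ _) x⁻¹x) ⟨
      (x⁻¹ * x) * a     ≈⟨ *-assoc _ _ _ ⟩
      x⁻¹ * (x * a)     ≈⟨ *-congˡ xa≈xb ⟩
      x⁻¹ * (x * b)     ≈⟨ *-assoc _ _ _ ⟨
      (x⁻¹ * x) * b     ≈⟨ *-congʳ (trans (*-comm _ _) x⁻¹x) ⟩
      1# * b            ≈⟨ *-identityˡ b ⟩
      b                 ∎
      where open Σ (inverse x x≉0) renaming (proj₁ to x⁻¹; proj₂ to x⁻¹x)

    -- φ replaces 0 by 1, so P = Π φ y is nonzero.  Multiplication by x ≉ 0 permutes the field and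
    -- x * φ y ≈ φ (x * y) except at y = 0, where the extra factor x appears (ψ); so x ^ L * P ≈ P * x.
    fermat-L : ∀ x → x ^ L ≈ x
    fermat-L x with x ≟ 0#
    ... | yes x≈0 = trans (^-congˡ L x≈0) (trans (0^ (index 0#)) (sym x≈0))
      where
      0^ : ∀ {m} → Fin m → 0# ^ m ≈ 0#
      0^ {suc m} _ = zeroˡ _
    ... | no x≉0 = *-cancelˡ (product≉0 (φ ∘ element) (φ≉0 ∘ element)) (trans (*-comm _ _) (begin
      x ^ L * P                                 ≈⟨ *-congʳ (Π*′.sum-replicate L) ⟨
      Π*.sum {L} (λ _ → x) * P                  ≈⟨ Π*.∑-distrib-+ (λ _ → x) (φ ∘ element) ⟨
      Π*.sum (λ i → x * φ (element i))          ≈⟨ Π*.sum-cong-≋ {x = λ i → x * φ (element i)} (λ i → scaled (element i)) ⟩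
      Π*.sum (λ i → φ (x * element i) * ψ (element i)) ≈⟨ Π*.∑-distrib-+ (λ i → φ (x * element i)) (ψ ∘ element) ⟩
      Π*.sum (λ i → φ (x * element i)) * Π*.sum (ψ ∘ element)
                                                ≈⟨ *-cong (sym (sum-bijection *-commutativeMonoid φ φ-cong (x *_) (x⁻¹ *_) *-congˡ *-congˡ cancel cancel′))
                                                          (trans (SparseSums.sum-single *-commutativeMonoid (ψ ∘ element) (index 0#) ψ≈1) ψ0≈x) ⟩
      P * x                                     ∎))
      where
      open Σ (inverse x x≉0) renaming (proj₁ to x⁻¹; proj₂ to xx⁻¹)
      φ : Carrier → Carrier
      φ y with y ≟ 0#
      ... | yes _ = 1#
      ... | no _  = y
      ψ : Carrier → Carrier
      ψ y with y ≟ 0#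
      ... | yes _ = x
      ... | no _  = 1#
      P = Π*.sum (φ ∘ element)
      φ≉0 : ∀ y → ¬ φ y ≈ 0#
      φ≉0 y with y ≟ 0#
      ... | yes _  = nontrivial
      ... | no y≉0 = y≉0
      φ-cong : ∀ {y z} → y ≈ z → φ y ≈ φ z
      φ-cong {y} {z} y≈z with y ≟ 0# | z ≟ 0#
      ... | yes _   | yes _   = refl
      ... | no _    | no _    = y≈z
      ... | yes y≈0 | no z≉0  = ⊥-elim (z≉0 (trans (sym y≈z) y≈0))
      ... | no y≉0  | yes z≈0 = ⊥-elim (y≉0 (trans y≈z z≈0))
      scaled : ∀ y → x * φ y ≈ φ (x * y) * ψ y
      scaled y with y ≟ 0# | x * y ≟ 0#
      ... | yes _   | yes _    = trans (*-identityʳ _) (sym (*-identityˡ _))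
      ... | yes y≈0 | no xy≉0  = ⊥-elim (xy≉0 (trans (*-congˡ y≈0) (zeroʳ _)))
      ... | no y≉0  | yes xy≈0 = ⊥-elim (y≉0 (x*y≈0⇒y≈0 x≉0 xy≈0))
      ... | no _    | no _     = sym (*-identityʳ _)
      ψ≈1 : ∀ i → i ≢ index 0# → ψ (element i) ≈ 1#
      ψ≈1 i i≢0 with element i ≟ 0#
      ... | yes e≈0 = ⊥-elim (i≢0 (≡.trans (≡.sym (index-element i)) (index-cong e≈0)))
      ... | no _    = refl
      ψ0≈x : ψ (element (index 0#)) ≈ x
      ψ0≈x with element (index 0#) ≟ 0#
      ... | yes _  = refl
      ... | no e≉0 = ⊥-elim (e≉0 (sym (element-index 0#)))
      cancel : ∀ y → x * (x⁻¹ * y) ≈ y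
      cancel y = trans (sym (*-assoc _ _ _)) (trans (*-congʳ xx⁻¹) (*-identityˡ y))
      cancel′ : ∀ y → x⁻¹ * (x * y) ≈ y
      cancel′ y = trans (sym (*-assoc _ _ _)) (trans (*-congʳ (trans (*-comm _ _) xx⁻¹)) (*-identityˡ y))

  fermat : ∀ x → x ^ N ≈ x
  fermat x = trans (reflexive (≡.cong (x ^_) (≡.sym card))) (fermat-L x)

module Cyclic (m : ℕ) where
  open import Data.Nat.DivMod using (_%_; m%n<n; m<n⇒m%n≡m; n%n≡0; [m+n]%n≡m%n)

  next : Fin (suc m) → Fin (suc m)
  next i = Fin.fromℕ< (m%n<n (suc (toℕ i)) (suc m))

  prev : Fin (suc m) → Fin (suc m)
  prev zero    = Fin.fromℕ m
  prev (suc i) = Fin.inject₁ i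

  next-suc : ∀ j → suc (toℕ j) ℕ.< suc m → toℕ (next j) ≡ suc (toℕ j)
  next-suc j j<m = ≡.trans (FinP.toℕ-fromℕ< _) (m<n⇒m%n≡m j<m)

  next-last : ∀ i → toℕ i ≡ m → toℕ (next i) ≡ 0
  next-last i i≡m = ≡.trans (FinP.toℕ-fromℕ< _) (≡.trans (≡.cong (λ x → suc x % suc m) i≡m) (n%n≡0 (suc m)))

  next-prev : ∀ i → next (prev i) ≡ i
  next-prev zero    = FinP.toℕ-injective (next-last (Fin.fromℕ m) (FinP.toℕ-fromℕ m))
  next-prev (suc i) = FinP.toℕ-injective (≡.trans (next-suc (Fin.inject₁ i) (≡.subst (λ x → suc x ℕ.< suc m) (≡.sym (FinP.toℕ-inject₁ i)) (ℕ.s≤s (FinP.toℕ<n i))))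
                                                  (≡.cong suc (FinP.toℕ-inject₁ i)))

  next-cases : ∀ i → (suc (toℕ i) ℕ.< suc m × toℕ (next i) ≡ suc (toℕ i)) ⊎ (toℕ i ≡ m × toℕ (next i) ≡ 0)
  next-cases i with suc (toℕ i) ℕ.<? suc m
  ... | yes i<m = inj₁ (i<m , next-suc i i<m)
  ... | no i≮m  = inj₂ (i≡m , next-last i i≡m)
    where i≡m = ℕP.≤-antisym (ℕP.≤-pred (FinP.toℕ<n i)) (ℕP.≤-pred (ℕP.≮⇒≥ i≮m))

  ⊖-next : ∀ i j → next j ⊖ next i ≡ j ⊖ i
  ⊖-next i j = FinP.toℕ-injective (≡.trans (FinP.toℕ-fromℕ< _) (≡.trans (shifted (next-cases i) (next-cases j)) (≡.sym (FinP.toℕ-fromℕ< _))))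
    where
    n = suc m
    a = toℕ i
    b = toℕ j
    shifted : _ → _ → (toℕ (next j) ℕ.+ (n ℕ.∸ toℕ (next i))) % n ≡ (b ℕ.+ (n ℕ.∸ a)) % n
    shifted (inj₁ (a<m , ei)) (inj₁ (_ , ej)) rewrite ei | ej =
      ≡.cong (_% n) (≡.sym (≡.trans (≡.cong (b ℕ.+_) (ℕP.+-∸-assoc 1 (ℕP.<⇒≤ (ℕP.≤-pred a<m)))) (ℕP.+-suc b (m ℕ.∸ a))))
    shifted (inj₂ (a≡m , ei)) (inj₁ (_ , ej)) rewrite ei | ej | a≡m =
      ≡.trans ([m+n]%n≡m%n (suc b) n) (≡.cong (_% n) (≡.sym (≡.trans (≡.cong (b ℕ.+_) (ℕP.m+n∸n≡m 1 m)) (ℕP.+-comm b 1))))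
    shifted (inj₁ (a<m , ei)) (inj₂ (b≡m , ej)) rewrite ei | ej | b≡m =
      ≡.sym (≡.trans (≡.cong (_% n) (≡.trans (≡.cong (m ℕ.+_) (ℕP.+-∸-assoc 1 (ℕP.<⇒≤ (ℕP.≤-pred a<m))))
        (≡.trans (ℕP.+-suc m (m ℕ.∸ a)) (ℕP.+-comm n (m ℕ.∸ a))))) ([m+n]%n≡m%n (m ℕ.∸ a) n))
    shifted (inj₂ (a≡m , ei)) (inj₂ (b≡m , ej)) rewrite ei | ej | a≡m | b≡m =
      ≡.cong (_% n) (≡.sym (≡.trans (≡.cong (m ℕ.+_) (ℕP.m+n∸n≡m 1 m)) (ℕP.+-comm m 1)))

module InitialSegments {c ℓ} (R : CommutativeRing c ℓ) where
  open CommutativeRing R hiding (zero)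
  open Over R using (Matrix; det; elems; principalMinor)
  open Determinant R using (det-cong)
  open import Data.Fin.Subset using (Subset; Side; inside; outside)
  open import Data.Fin.Subset.Properties using (_∈?_)
  open import Data.Vec using ([]; _∷_)
  open import Data.List using (List; []; _∷_; filter; tabulate; length; lookup)
  open import Relation.Nullary using (does)
  open import Data.Bool using (true; false)

  initialSegment : ∀ n → ℕ → Subset n
  initialSegment zero    k       = []
  initialSegment (suc n) zero    = outside ∷ initialSegment n zero
  initialSegment (suc n) (suc k) = inside ∷ initialSegment n k

  private
    filter-map-suc : ∀ {n} (side : Side) (α : Subset n) (xs : List (Fin n)) →
                     filter (_∈? (side ∷ α)) (List.map suc xs) ≡ List.map suc (filter (_∈? α) xs)
    filter-map-suc side α []       = ≡.refl
    filter-map-suc side α (x ∷ xs) with does (x ∈? α)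
    ... | true  = ≡.cong (suc x ∷_) (filter-map-suc side α xs)
    ... | false = filter-map-suc side α xs

    elems-cons : ∀ {n} (side : Side) (α : Subset n) → filter (_∈? (side ∷ α)) (tabulate suc) ≡ List.map suc (elems α)
    elems-cons side α = ≡.trans (≡.cong (filter (_∈? (side ∷ α))) (≡.sym (ListP.map-tabulate id suc))) (filter-map-suc side α (allFin _))

  elems-initialSegment : ∀ n k (k≤n : k ℕ.≤ n) → elems (initialSegment n k) ≡ tabulate (λ i → Fin.inject≤ i k≤n)
  elems-initialSegment zero    zero    ℕ.z≤n       = ≡.refl
  elems-initialSegment (suc n) zero    ℕ.z≤n       = ≡.trans (elems-cons outside (initialSegment n zero)) (≡.cong (List.map suc) (elems-initialSegment n zero ℕ.z≤n))
  elems-initialSegment (suc n) (suc k) (ℕ.s≤s k≤n) = ≡.cong (zero ∷_) (≡.trans (elems-cons inside (initialSegment n k))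
    (≡.trans (≡.cong (List.map suc) (elems-initialSegment n k k≤n)) (ListP.map-tabulate _ suc)))

  length-elems-initialSegment : ∀ {n k} (k≤n : k ℕ.≤ n) → length (elems (initialSegment n k)) ≡ k
  length-elems-initialSegment {n} {k} k≤n = ≡.trans (≡.cong length (elems-initialSegment n k k≤n)) (ListP.length-tabulate _)

  principalMinor-initialSegment : ∀ {n k} (k≤n : k ℕ.≤ n) (A : Matrix n) →
                                  principalMinor A (initialSegment n k) ≈ det (λ i j → A (Fin.inject≤ i k≤n) (Fin.inject≤ j k≤n))
  principalMinor-initialSegment {n} {k} k≤n A = minor-tabulate _ (elems-initialSegment n k k≤n)
    where
    det-cast : ∀ {a b} (a≡b : a ≡ b) (M : Matrix a) → det M ≈ det (λ i j → M (Fin.cast (≡.sym a≡b) i) (Fin.cast (≡.sym a≡b) j))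
    det-cast ≡.refl M = det-cong (λ i j → reflexive (≡.cong₂ M (≡.sym (FinP.cast-is-id _ i)) (≡.sym (FinP.cast-is-id _ j))))
    f : Fin k → Fin n
    f i = Fin.inject≤ i k≤n
    minor-tabulate : ∀ xs → xs ≡ tabulate f → det {length xs} (λ i j → A (lookup xs i) (lookup xs j)) ≈ det (λ i j → A (f i) (f j))
    minor-tabulate _ ≡.refl = trans (det-cast (ListP.length-tabulate f) _)
      (det-cong (λ i j → reflexive (≡.cong₂ A (ListP.lookup-tabulate f i) (ListP.lookup-tabulate f j))))

module Dickson {c ℓ} (R : CommutativeRing c ℓ) where
  open CommutativeRing R hiding (zero)
  open Over R using (Matrix; pow; IsDickson; IsRank; principalMinor; elems)
  open import Algebra.Properties.Semiring.Exp semiring using (_^_; ^-congˡ; ^-assocʳ)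
  open import Data.List using (lookup)
  open InitialSegments R
  open import Relation.Binary.Reasoning.Setoid setoid

  pow≈^ : ∀ x e → pow x e ≈ x ^ e
  pow≈^ x zero    = refl
  pow≈^ x (suc e) = *-congˡ (pow≈^ x e)

  module _ (F : IsDiscreteField R) (q m : ℕ) (frobenius : IsNearSemiringEndomorphism R (_^ q))
           (fermat : ∀ x → x ^ (q ℕ.^ suc m) ≈ x) where
    open Cyclic m
    open ShiftInvariant R F (_^ q) frobenius next prev next-suc next-prev
    open Determinant R using (nonzeroMinor⇒≤)

    dickson⇒shiftInvariant : ∀ A → IsDickson q (suc m) A → IsShiftInvariant A
    dickson⇒shiftInvariant A (a , A≈) i j = begin
      A i j ^ q                                    ≈⟨ ^-congˡ q (trans (A≈ i j) (pow≈^ x (q ℕ.^ toℕ i))) ⟩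
      (x ^ (q ℕ.^ toℕ i)) ^ q                      ≈⟨ ^-assocʳ x (q ℕ.^ toℕ i) q ⟩
      x ^ (q ℕ.^ toℕ i ℕ.* q)                      ≈⟨ raise (next-cases i) ⟩
      x ^ (q ℕ.^ toℕ (next i))                     ≡⟨ ≡.cong (λ d → a d ^ (q ℕ.^ toℕ (next i))) (⊖-next i j) ⟨
      a (next j ⊖ next i) ^ (q ℕ.^ toℕ (next i))   ≈⟨ trans (A≈ (next i) (next j)) (pow≈^ (a (next j ⊖ next i)) (q ℕ.^ toℕ (next i))) ⟨
      A (next i) (next j)                          ∎
      where
      x = a (j ⊖ i)
      -- At the wrap-around i = n − 1 the exponent is q ^ n, and x ^ (q ^ n) ≈ x.
      raise : _ → x ^ (q ℕ.^ toℕ i ℕ.* q) ≈ x ^ (q ℕ.^ toℕ (next i))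
      raise (inj₁ (_ , i+1≡next)) = reflexive (≡.cong (x ^_) (≡.trans (ℕP.*-comm (q ℕ.^ toℕ i) q) (≡.cong (q ℕ.^_) (≡.sym i+1≡next))))
      raise (inj₂ (i≡m , next≡0)) = begin
        x ^ (q ℕ.^ toℕ i ℕ.* q)   ≡⟨ ≡.cong (λ e → x ^ (e ℕ.* q)) (≡.cong (q ℕ.^_) i≡m) ⟩
        x ^ (q ℕ.^ m ℕ.* q)       ≡⟨ ≡.cong (x ^_) (ℕP.*-comm (q ℕ.^ m) q) ⟩
        x ^ (q ℕ.^ suc m)         ≈⟨ fermat x ⟩
        x                         ≈⟨ *-identityʳ x ⟨
        x ^ 1                     ≡⟨ ≡.cong (λ e → x ^ (q ℕ.^ e)) next≡0 ⟨
        x ^ (q ℕ.^ toℕ (next i))  ∎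

    samePrincipalMinors⇒rank≤ : ∀ (A B : Matrix (suc m)) → IsDickson q (suc m) A → (∀ α → principalMinor A α ≈ principalMinor B α) →
            ∀ r s → IsRank A r → IsRank B s → r ℕ.≤ s
    samePrincipalMinors⇒rank≤ A B dicksonA minors r s rankA (_ , maximalB) =
      ≡.subst (ℕ._≤ s) (length-elems-initialSegment r≤n) (maximalB _ (lookup rows , lookup rows , minor≉0 ∘ trans (minors α)))
      where
      r≤n = nonzeroMinor⇒≤ A (proj₁ rankA)
      α = initialSegment (suc m) r
      rows = elems α
      minor≉0 : ¬ principalMinor A α ≈ 0#
      minor≉0 minor≈0 = leadingPrincipalMinor≉0 A (dickson⇒shiftInvariant A dicksonA) r rankA r≤n
                          (trans (sym (principalMinor-initialSegment r≤n A)) minor≈0)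

open import Data.Nat using (_^_)
open import Data.Fin.Subset using (Subset)

-- Only n = suc m needs a clause: the NonZero instance rules out n = 0.
mainTheorem10 : {c ℓ : Level} (R : CommutativeRing c ℓ) (q n : ℕ) .{{_ : NonZero n}} →
    IsPrimePower q →
    Over.IsFiniteFieldOfOrder R (q ^ n) →
    (A B : Over.Matrix R n) →
    Over.IsDickson R q n A → Over.IsDickson R q n B →
    (∀ (α : Subset n) → CommutativeRing._≈_ R (Over.principalMinor R A α) (Over.principalMinor R B α)) →
    ∀ r s → Over.IsRank R A r → Over.IsRank R B s → r ≡ s
mainTheorem10 R q (suc m) (p , k , p-prime , _ , ≡.refl) F A B dicksonA dicksonB minors r s rankA rankB =
  ℕP.≤-antisym (rank≤ A B dicksonA minors r s rankA rankB) (rank≤ B A dicksonB (sym ∘ minors) s r rankB rankA)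
  where
  open CommutativeRing R using (sym)
  module 𝔽 = FiniteField R F
  frobenius = Frobenius.frobenius-endomorphism R p-prime (𝔽.characteristic (k ℕ.* suc m) (ℕP.^-*-assoc p k (suc m))) k
  rank≤ = Dickson.samePrincipalMinors⇒rank≤ R 𝔽.isDiscreteField (p ^ k) m frobenius 𝔽.fermat
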